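{- Let $a,b>2$ be integers and let $G_{a,b}$ be the grid graph with vertex set $\{1,\dots,a\}\times\{1,\dots,b\}$, two vertices being adjacent iff they differ by $1$ in exactly one coordinate and agree in the other. Then the upper traceable number of $G_{a,b}$ is $$ t^+(G_{a,b}) = \begin{cases} \dfrac{a^2b+b^2a}{2}-3, & \text{if } a,b \text{ are both even},\\[1em] \dfrac{a^2b+b^2a-a}{2}-1, & \text{if } a \text{ is even and } b \text{ is odd},\\[1em] \dfrac{a^2b+b^2a-a-b}{2}-1, & \text{if } a,b \text{ are both odd}. \end{cases} $$ (The case $a$ odd, $b$ even is obtained from the case $a$ even, $b$ odd by interchanging the roles of $a$ and $b$.)
   Context: For a connected graph $G$ on $n$ vertices with graph distance $d$, the upper traceable number $t^+(G)$ is the maximum, over all orderings $u_1,u_2,\dots,u_n$ of the vertices of $G$ (each vertex appearing exactly once), of $\sum_{i=1}^{n-1} d(u_i,u_{i+1})$. In $G_{a,b}$ the distance between $(x,y)$ and $(x',y')$ is $|x-x'|+|y-y'|$. -}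

module Defs where

open import Data.Nat using (ℕ; zero; suc; _+_; _*_; _∸_; _≤_; ∣_-_∣)
open import Data.Fin using (Fin; toℕ; inject₁)
import Data.Fin as F
open import Data.Product using (_×_; _,_; Σ; ∃)
open import Function.Definitions using (Bijective)
open import Relation.Binary.PropositionalEquality using (_≡_)

-- Vertices of the grid graph G_{a,b}: {1..a} × {1..b}, represented 0-indexed
-- by Fin a × Fin b (distances only depend on coordinate differences).
Vertex : ℕ → ℕ → Set
Vertex a b = Fin a × Fin b

gridDist : ∀ {a b} → Vertex a b → Vertex a b → ℕ
gridDist (x , y) (x' , y') = ∣ toℕ x - toℕ x' ∣ + ∣ toℕ y - toℕ y' ∣

Ordering : ∀ {V : Set} (n : ℕ) → (Fin n → V) → Set
Ordering n u = Bijective _≡_ _≡_ u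

pathSum : ∀ {V : Set} (d : V → V → ℕ) (n : ℕ) → (Fin n → V) → ℕ
pathSum d zero u = 0
pathSum d (suc zero) u = 0
pathSum d (suc (suc n)) u =
  d (u F.zero) (u (F.suc F.zero)) + pathSum d (suc n) (λ i → u (F.suc i))

IsUpperTraceableNumber : ∀ {V : Set} (n : ℕ) (d : V → V → ℕ) → ℕ → Set
IsUpperTraceableNumber {V} n d t =
  (Σ (Fin n → V) λ u → Ordering n u × pathSum d n u ≡ t)
  × (∀ (u : Fin n → V) → Ordering n u → pathSum d n u ≤ t)

GridUpperTraceable : ℕ → ℕ → ℕ → Set
GridUpperTraceable a b t =
  IsUpperTraceableNumber (a * b) (gridDist {a} {b}) t

module Submission where

-- Work in doubled coordinates around the centre of the grid.  The potential
-- h(x,y) = |2x - (a-1)| + |2y - (b-1)| is twice the ℓ¹-distance to the centre, and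
-- the triangle inequality through the centre gives 2 d(v,w) ≤ h(v) + h(w) with some
-- slack s(v,w).  Telescoping along an ordering u₁, …, uₙ of all vertices yields
--   2 · Σᵢ d(uᵢ, uᵢ₊₁) + excess = 2 · total,   excess = Σᵢ s(uᵢ, uᵢ₊₁) + h(u₁) + h(uₙ),
-- where total = Σ_v h(v) has a closed form (ordering-identity).  So t⁺ is total minus
-- half the least possible excess, which is
--   6 when a and b are even: every vertex has h ≥ 2, and a two-colouring of the grid
--     preserved by slackless steps forces some slack;
--   2 otherwise: an end of positive potential is unavoidable (one side even: every
--     vertex; both odd: only the centre has h = 0), and parity rounds 1 up to 2.
-- These excesses are attained by explicit tours that alternate the vertices of one
-- half of the grid with their mirror images under the central reflection.

open import Data.Bool using (Bool; true; false; not; _xor_)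
open import Data.Bool.Properties using (not-distribˡ-xor; not-distribʳ-xor; not-involutive)
open import Data.Empty using (⊥-elim)
open import Data.Fin as F using (Fin; toℕ; _↑ˡ_; _↑ʳ_; combine; remQuot)
import Data.Fin.Properties as FinP
open import Data.Fin.Permutation using (Permutation; _⟨$⟩ʳ_)
open import Data.List using (List; []; _∷_; length; lookup; _++_)
open import Data.List.Membership.Propositional using (_∈_)
open import Data.List.Membership.Propositional.Properties using (∈-++⁺ˡ; ∈-++⁺ʳ)
open import Data.List.Properties using (length-++; ++-assoc)
open import Data.List.Relation.Unary.All as All using (All; []; _∷_)
open import Data.List.Relation.Unary.All.Properties using () renaming (++⁺ to All++⁺)
open import Data.List.Relation.Unary.Any using (here; there; index)
open import Data.List.Relation.Unary.Any.Properties using (lookup-index)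
open import Data.List.Relation.Unary.Linked using (Linked; []; [-]; _∷_)
open import Data.Nat using (ℕ; zero; suc; _+_; _*_; _∸_; _≤_; _<_; z≤n; s≤s; ∣_-_∣; _≤?_; _<?_; _/_)
import Data.Nat as ℕ
open import Data.Nat.Divisibility using (_∣_; divides)
open import Data.Nat.DivMod using (m*n/n≡m)
open import Data.Nat.Properties
open import Data.Nat.Tactic.RingSolver using (solve-∀)
open import Data.Product using (_×_; _,_; Σ; ∃; proj₁; proj₂; uncurry)
open import Data.Sum using (_⊎_; inj₁; inj₂)
open import Function using (_∘_; id)
open import Function.Bundles using (mk⤖)
import Function.Construct.Composition as Compose
open import Function.Definitions using (Bijective; Injective; Surjective)
open import Function.Properties.Bijection using (Bijection⇒Inverse)
open import Relation.Binary.Definitions using (tri<; tri≈; tri>)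
open import Relation.Binary.PropositionalEquality
open import Relation.Nullary using (¬_; yes; no; does)
open import Relation.Nullary.Decidable using (dec-true; dec-false)
import Algebra.Properties.CommutativeMonoid.Sum as MonoidSum

open import Defs

open MonoidSum +-0-commutativeMonoid using (sum; sum-cong-≗; ∑-distrib-+; sum-permute; sum-init-last)

sum-const : ∀ n k → sum {n} (λ _ → k) ≡ n * k
sum-const zero k = refl
sum-const (suc n) k = cong (k +_) (sum-const n k)

sum-scale : ∀ n k (f : Fin n → ℕ) → sum (λ i → k * f i) ≡ k * sum f
sum-scale zero k f = sym (*-zeroʳ k)
sum-scale (suc n) k f = trans (cong (k * f F.zero +_) (sum-scale n k (f ∘ F.suc))) (sym (*-distribˡ-+ k _ _))

sum-↑ : ∀ m n (f : Fin (m + n) → ℕ) → sum f ≡ sum (λ i → f (i ↑ˡ n)) + sum (λ j → f (m ↑ʳ j))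
sum-↑ zero n f = refl
sum-↑ (suc m) n f = trans (cong (f F.zero +_) (sum-↑ m n (f ∘ F.suc))) (sym (+-assoc (f F.zero) _ _))

sum-remQuot : ∀ a b (f : Fin a × Fin b → ℕ) → sum (f ∘ remQuot b) ≡ sum (λ x → sum (λ y → f (x , y)))
sum-remQuot zero b f = refl
sum-remQuot (suc a) b f = trans (sum-↑ b (a * b) _) (cong₂ _+_
  (sum-cong-≗ (λ j → cong f (FinP.remQuot-combine {suc a} F.zero j)))
  (trans (sum-cong-≗ (λ k → cong f (remQuot-↑ʳ k))) (sum-remQuot a b (λ (x , y) → f (F.suc x , y)))))
  where
  remQuot-↑ʳ : ∀ k → remQuot {suc a} b (b ↑ʳ k) ≡ (F.suc (proj₁ (remQuot {a} b k)) , proj₂ (remQuot {a} b k))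
  remQuot-↑ʳ k rewrite FinP.splitAt-↑ʳ b (a * b) k = refl

combine-bijective : ∀ {a b} → Bijective _≡_ _≡_ (uncurry (combine {a} {b}))
combine-bijective {a} {b} = injective , surjective
  where
  injective : Injective _≡_ _≡_ (uncurry (combine {a} {b}))
  injective {x} {y} eq = trans (sym (FinP.remQuot-combine (proj₁ x) (proj₂ x)))
                        (trans (cong (remQuot b) eq) (FinP.remQuot-combine (proj₁ y) (proj₂ y)))
  surjective : Surjective _≡_ _≡_ (uncurry (combine {a} {b}))
  surjective k = remQuot b k , λ { refl → FinP.combine-remQuot {a} b k }

sum-bijection : ∀ {a b n} (f : Fin a × Fin b → ℕ) (u : Fin n → Fin a × Fin b) → Bijective _≡_ _≡_ u →
  sum (f ∘ u) ≡ sum (λ x → sum (λ y → f (x , y)))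
sum-bijection {a} {b} {n} f u bij = begin
    sum (f ∘ u)
  ≡⟨ sum-cong-≗ (λ i → cong f (sym (FinP.remQuot-combine (proj₁ (u i)) (proj₂ (u i))))) ⟩
    sum (λ i → g (π ⟨$⟩ʳ i))
  ≡⟨ sum-permute g π ⟨
    sum g
  ≡⟨ sum-remQuot a b f ⟩
    sum (λ x → sum (λ y → f (x , y))) ∎
  where
  open ≡-Reasoning
  g : Fin (a * b) → ℕ
  g = f ∘ remQuot b
  π : Permutation n (a * b)
  π = Bijection⇒Inverse (mk⤖ (Compose.bijective _≡_ _≡_ _≡_ bij combine-bijective))

sum-separable : ∀ a b (F G : ℕ → ℕ) →
  sum (λ (x : Fin a) → sum (λ (y : Fin b) → F (toℕ x) + G (toℕ y)))
  ≡ b * sum (λ (x : Fin a) → F (toℕ x)) + a * sum (λ (y : Fin b) → G (toℕ y))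
sum-separable a b F G = begin
    sum (λ (x : Fin a) → sum (λ (y : Fin b) → F (toℕ x) + G (toℕ y)))
  ≡⟨ sum-cong-≗ {a} (λ x → trans (∑-distrib-+ {b} (λ _ → F (toℕ x)) (G ∘ toℕ)) (cong (_+ ΣG) (sum-const b (F (toℕ x))))) ⟩
    sum (λ (x : Fin a) → b * F (toℕ x) + ΣG)
  ≡⟨ ∑-distrib-+ {a} (λ x → b * F (toℕ x)) (λ _ → ΣG) ⟩
    sum (λ (x : Fin a) → b * F (toℕ x)) + sum {a} (λ _ → ΣG)
  ≡⟨ cong₂ _+_ (sum-scale a b (F ∘ toℕ)) (sum-const a ΣG) ⟩
    b * sum (λ (x : Fin a) → F (toℕ x)) + a * ΣG ∎
  where
  open ≡-Reasoning
  ΣG = sum (λ (y : Fin b) → G (toℕ y))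

∣-∣+left : ∀ {m n} → m ≤ n → ∣ m - n ∣ + m ≡ n
∣-∣+left {m} {n} le = trans (cong (_+ m) (m≤n⇒∣m-n∣≡n∸m le)) (m∸n+n≡m le)

∣-∣+right : ∀ {m n} → n ≤ m → ∣ m - n ∣ + n ≡ m
∣-∣+right {m} {n} le = trans (cong (_+ n) (m≤n⇒∣n-m∣≡n∸m le)) (m∸n+n≡m le)

∣-∣-via : ∀ X Y c → ∣ X - Y ∣ ≤ ∣ X - c ∣ + ∣ Y - c ∣
∣-∣-via X Y c = subst (λ z → ∣ X - Y ∣ ≤ ∣ X - c ∣ + z) (∣-∣-comm c Y) (∣-∣-triangle X c Y)

∣-∣-via-swap : ∀ {c} X Y → ∣ X - Y ∣ ≡ ∣ X - c ∣ + ∣ Y - c ∣ → ∣ Y - X ∣ ≡ ∣ Y - c ∣ + ∣ X - c ∣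
∣-∣-via-swap {c} X Y e = trans (∣-∣-comm Y X) (trans e (+-comm ∣ X - c ∣ ∣ Y - c ∣))

Opposite : ℕ → ℕ → ℕ → Set
Opposite c X Y = (X ≤ c × c ≤ Y) ⊎ (Y ≤ c × c ≤ X)

opposite⇒∣-∣-via : ∀ {c X Y} → Opposite c X Y → ∣ X - Y ∣ ≡ ∣ X - c ∣ + ∣ Y - c ∣
opposite⇒∣-∣-via {c} {X} {Y} (inj₁ (Xc , cY)) = +-cancelʳ-≡ X _ _ (begin
    ∣ X - Y ∣ + X                 ≡⟨ ∣-∣+left (≤-trans Xc cY) ⟩
    Y                             ≡⟨ ∣-∣+right cY ⟨
    ∣ Y - c ∣ + c                 ≡⟨ cong (∣ Y - c ∣ +_) (∣-∣+left Xc) ⟨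
    ∣ Y - c ∣ + (∣ X - c ∣ + X)   ≡⟨ regroup ∣ Y - c ∣ ∣ X - c ∣ X ⟩
    ∣ X - c ∣ + ∣ Y - c ∣ + X     ∎)
  where
  open ≡-Reasoning
  regroup : ∀ p q x → p + (q + x) ≡ q + p + x
  regroup = solve-∀
opposite⇒∣-∣-via {c} {X} {Y} (inj₂ YcX) = ∣-∣-via-swap Y X (opposite⇒∣-∣-via (inj₁ YcX))

-- ... whereas strictly on the same side it is not.  For X ≤ Y below c, going from X
-- to Y would have to cover the whole way from X to c; symmetrically above c.
below-ordered-strict : ∀ {X Y c} → X < c → Y < c → X ≤ Y → ∣ X - Y ∣ ≢ ∣ X - c ∣ + ∣ Y - c ∣
below-ordered-strict {X} {Y} {c} Xc Yc XY e = <⇒≱ Yc (begin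
    c              ≡⟨ ∣-∣+left (<⇒≤ Xc) ⟨
    ∣ X - c ∣ + X  ≤⟨ +-monoˡ-≤ X (subst (∣ X - c ∣ ≤_) (sym e) (m≤m+n _ _)) ⟩
    ∣ X - Y ∣ + X  ≡⟨ ∣-∣+left XY ⟩
    Y              ∎)
  where open ≤-Reasoning

above-ordered-strict : ∀ {X Y c} → c < X → c < Y → X ≤ Y → ∣ X - Y ∣ ≢ ∣ X - c ∣ + ∣ Y - c ∣
above-ordered-strict {X} {Y} {c} cX cY XY e = <⇒≱ cX (+-cancelˡ-≤ ∣ X - Y ∣ X c (begin
    ∣ X - Y ∣ + X  ≡⟨ cong (_+ X) (∣-∣-comm X Y) ⟩
    ∣ Y - X ∣ + X  ≡⟨ ∣-∣+right XY ⟩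
    Y              ≡⟨ ∣-∣+right (<⇒≤ cY) ⟨
    ∣ Y - c ∣ + c  ≤⟨ +-monoˡ-≤ c (subst (∣ Y - c ∣ ≤_) (sym e) (m≤n+m _ _)) ⟩
    ∣ X - Y ∣ + c  ∎))
  where open ≤-Reasoning

below⇒∣-∣-via-strict : ∀ {X Y c} → X < c → Y < c → ∣ X - Y ∣ ≢ ∣ X - c ∣ + ∣ Y - c ∣
below⇒∣-∣-via-strict {X} {Y} Xc Yc e with ≤-total X Y
... | inj₁ XY = below-ordered-strict Xc Yc XY e
... | inj₂ YX = below-ordered-strict Yc Xc YX (∣-∣-via-swap X Y e)

above⇒∣-∣-via-strict : ∀ {X Y c} → c < X → c < Y → ∣ X - Y ∣ ≢ ∣ X - c ∣ + ∣ Y - c ∣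
above⇒∣-∣-via-strict {X} {Y} cX cY e with ≤-total X Y
... | inj₁ XY = above-ordered-strict cX cY XY e
... | inj₂ YX = above-ordered-strict cY cX YX (∣-∣-via-swap X Y e)

-- Doubling, by structural recursion so that even and odd numbers can be matched
-- as dbl k and suc (dbl k).
dbl : ℕ → ℕ
dbl zero = 0
dbl (suc n) = suc (suc (dbl n))

dbl≡2* : ∀ n → dbl n ≡ 2 * n
dbl≡2* zero = refl
dbl≡2* (suc n) = trans (cong (suc ∘ suc) (dbl≡2* n)) (step n)
  where
  step : ∀ n → suc (suc (2 * n)) ≡ 2 * suc n
  step = solve-∀

dbl≡+ : ∀ n → dbl n ≡ n + n
dbl≡+ n = trans (dbl≡2* n) (cong (n +_) (+-identityʳ n))

dbl-injective : ∀ m n → dbl m ≡ dbl n → m ≡ n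
dbl-injective zero zero e = refl
dbl-injective (suc m) (suc n) e = cong suc (dbl-injective m n (suc-injective (suc-injective e)))

dbl≢odd : ∀ m n → dbl m ≢ suc (dbl n)
dbl≢odd m n e = even≢odd m n (trans (sym (dbl≡2* m)) (trans e (cong suc (dbl≡2* n))))

dbl-mono : ∀ {m n} → m ≤ n → dbl m ≤ dbl n
dbl-mono z≤n = z≤n
dbl-mono (s≤s le) = s≤s (s≤s (dbl-mono le))

dbl-+ : ∀ m n → dbl (m + n) ≡ dbl m + dbl n
dbl-+ zero n = refl
dbl-+ (suc m) n = cong (suc ∘ suc) (dbl-+ m n)

n≤dbl : ∀ n → n ≤ dbl n
n≤dbl n = subst (n ≤_) (sym (dbl≡+ n)) (m≤m+n n n)

dbl∸ : ∀ n → dbl n ∸ n ≡ n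
dbl∸ n = trans (cong (_∸ n) (dbl≡+ n)) (m+n∸m≡n n n)

Point : Set
Point = ℕ × ℕ

toPoint : ∀ {a b} → Vertex a b → Point
toPoint (x , y) = (toℕ x , toℕ y)

dist : Point → Point → ℕ
dist (x , y) (x' , y') = ∣ x - x' ∣ + ∣ y - y' ∣

-- With doubled coordinates every centre c (c = n - 1 for a side of length n) is
-- an integer.  fromCentre c x = |2x - c| is twice the distance from x to the centre,
-- and the potential of a point is the sum over both coordinates.
fromCentre : ℕ → ℕ → ℕ
fromCentre c x = ∣ dbl x - c ∣

potential : ℕ → ℕ → Point → ℕ
potential ca cb (x , y) = fromCentre ca x + fromCentre cb y

slack : ℕ → ℕ → Point → Point → ℕ
slack ca cb v w = potential ca cb v + potential ca cb w ∸ 2 * dist v w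

twice-dist : ∀ x y x' y' → 2 * dist (x , y) (x' , y') ≡ ∣ dbl x - dbl x' ∣ + ∣ dbl y - dbl y' ∣
twice-dist x y x' y' = trans (*-distribˡ-+ 2 ∣ x - x' ∣ ∣ y - y' ∣) (cong₂ _+_ (twice x x') (twice y y'))
  where
  twice : ∀ m n → 2 * ∣ m - n ∣ ≡ ∣ dbl m - dbl n ∣
  twice m n = trans (*-distribˡ-∣-∣ 2 m n) (sym (cong₂ ∣_-_∣ (dbl≡2* m) (dbl≡2* n)))

regroup₄ : ∀ p q r t → (p + q) + (r + t) ≡ (p + r) + (q + t)
regroup₄ = solve-∀

-- The triangle inequality through the centre, in both coordinates.
twice-dist≤potential : ∀ ca cb v w → 2 * dist v w ≤ potential ca cb v + potential ca cb w
twice-dist≤potential ca cb (x , y) (x' , y') = begin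
    2 * dist (x , y) (x' , y')
  ≡⟨ twice-dist x y x' y' ⟩
    ∣ dbl x - dbl x' ∣ + ∣ dbl y - dbl y' ∣
  ≤⟨ +-mono-≤ (∣-∣-via (dbl x) (dbl x') ca) (∣-∣-via (dbl y) (dbl y') cb) ⟩
    (fromCentre ca x + fromCentre ca x') + (fromCentre cb y + fromCentre cb y')
  ≡⟨ regroup₄ (fromCentre ca x) (fromCentre ca x') (fromCentre cb y) (fromCentre cb y') ⟩
    potential ca cb (x , y) + potential ca cb (x' , y') ∎
  where open ≤-Reasoning

dist-slack : ∀ ca cb v w → 2 * dist v w + slack ca cb v w ≡ potential ca cb v + potential ca cb w
dist-slack ca cb v w = m+[n∸m]≡n (twice-dist≤potential ca cb v w)

slack-zero : ∀ ca cb x y x' y' → Opposite ca (dbl x) (dbl x') → Opposite cb (dbl y) (dbl y') →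
  slack ca cb (x , y) (x' , y') ≡ 0
slack-zero ca cb x y x' y' ox oy = begin
    H ∸ 2 * dist (x , y) (x' , y')
  ≡⟨ cong (H ∸_) (trans (twice-dist x y x' y') (cong₂ _+_ (opposite⇒∣-∣-via ox) (opposite⇒∣-∣-via oy))) ⟩
    H ∸ ((fromCentre ca x + fromCentre ca x') + (fromCentre cb y + fromCentre cb y'))
  ≡⟨ cong (H ∸_) (regroup₄ (fromCentre ca x) (fromCentre ca x') (fromCentre cb y) (fromCentre cb y')) ⟩
    H ∸ H
  ≡⟨ n∸n≡0 H ⟩
    0 ∎
  where
  open ≡-Reasoning
  H = potential ca cb (x , y) + potential ca cb (x' , y')

slack-opposite-x : ∀ ca cb x y x' y' → Opposite ca (dbl x) (dbl x') →
  slack ca cb (x , y) (x' , y') ≡ (fromCentre cb y + fromCentre cb y') ∸ ∣ dbl y - dbl y' ∣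
slack-opposite-x ca cb x y x' y' ox = begin
    (fromCentre ca x + fromCentre cb y) + (fromCentre ca x' + fromCentre cb y') ∸ 2 * dist (x , y) (x' , y')
  ≡⟨ cong₂ _∸_ (regroup₄ (fromCentre ca x) (fromCentre cb y) (fromCentre ca x') (fromCentre cb y'))
               (trans (twice-dist x y x' y') (cong (_+ ∣ dbl y - dbl y' ∣) (opposite⇒∣-∣-via ox))) ⟩
    (fromCentre ca x + fromCentre ca x') + (fromCentre cb y + fromCentre cb y') ∸ ((fromCentre ca x + fromCentre ca x') + ∣ dbl y - dbl y' ∣)
  ≡⟨ [m+n]∸[m+o]≡n∸o (fromCentre ca x + fromCentre ca x') _ _ ⟩
    (fromCentre cb y + fromCentre cb y') ∸ ∣ dbl y - dbl y' ∣ ∎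
  where open ≡-Reasoning

slack-zero⇒tight : ∀ ca cb x y x' y' → slack ca cb (x , y) (x' , y') ≡ 0 →
  (∣ dbl x - dbl x' ∣ ≡ fromCentre ca x + fromCentre ca x') × (∣ dbl y - dbl y' ∣ ≡ fromCentre cb y + fromCentre cb y')
slack-zero⇒tight ca cb x y x' y' s≡0 = tight viaX viaY both , tight viaY viaX (trans (+-comm ∣ dbl y - dbl y' ∣ ∣ dbl x - dbl x' ∣)
  (trans both (+-comm (fromCentre ca x + fromCentre ca x') (fromCentre cb y + fromCentre cb y'))))
  where
  viaX = ∣-∣-via (dbl x) (dbl x') ca
  viaY = ∣-∣-via (dbl y) (dbl y') cb
  both : ∣ dbl x - dbl x' ∣ + ∣ dbl y - dbl y' ∣ ≡ (fromCentre ca x + fromCentre ca x') + (fromCentre cb y + fromCentre cb y')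
  both = trans (sym (twice-dist x y x' y'))
    (trans (≤-antisym (twice-dist≤potential ca cb (x , y) (x' , y')) (m∸n≡0⇒m≤n s≡0))
           (regroup₄ (fromCentre ca x) (fromCentre cb y) (fromCentre ca x') (fromCentre cb y')))
  tight : ∀ {p q r t} → p ≤ q → r ≤ t → p + r ≡ q + t → p ≡ q
  tight {p} {q} {r} {t} pq rt e = ≤-antisym pq (+-cancelʳ-≤ t q p (subst (_≤ p + t) e (+-monoʳ-≤ p rt)))

path-identity : ∀ {V : Set} (d s : V → V → ℕ) (h : V → ℕ) →
  (∀ v w → 2 * d v w + s v w ≡ h v + h w) →
  ∀ m (u : Fin (suc m) → V) →
  2 * pathSum d (suc m) u + (pathSum s (suc m) u + h (u F.zero) + h (u (F.fromℕ m))) ≡ 2 * sum (h ∘ u)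
path-identity d s h step zero u = single (h (u F.zero))
  where
  single : ∀ x → 2 * 0 + (0 + x + x) ≡ 2 * (x + 0)
  single = solve-∀
path-identity d s h step (suc m) u = begin
    2 * (d₀₁ + P) + ((s₀₁ + S) + h₀ + hₗ) ≡⟨ regroup d₀₁ s₀₁ P S h₀ hₗ ⟩
    (2 * d₀₁ + s₀₁) + (2 * P + (S + hₗ)) + h₀ ≡⟨ cong (λ z → z + (2 * P + (S + hₗ)) + h₀) (step (u F.zero) (u (F.suc F.zero))) ⟩
    (h₀ + h₁) + (2 * P + (S + hₗ)) + h₀ ≡⟨ regroup′ h₀ h₁ P S hₗ ⟩
    (2 * P + (S + h₁ + hₗ)) + 2 * h₀ ≡⟨ cong (_+ 2 * h₀) (path-identity d s h step m (u ∘ F.suc)) ⟩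
    2 * sum (h ∘ u ∘ F.suc) + 2 * h₀ ≡⟨ trans (+-comm _ (2 * h₀)) (sym (*-distribˡ-+ 2 h₀ _)) ⟩
    2 * sum (h ∘ u) ∎
  where
  open ≡-Reasoning
  d₀₁ = d (u F.zero) (u (F.suc F.zero))
  s₀₁ = s (u F.zero) (u (F.suc F.zero))
  P = pathSum d (suc m) (u ∘ F.suc)
  S = pathSum s (suc m) (u ∘ F.suc)
  h₀ = h (u F.zero)
  h₁ = h (u (F.suc F.zero))
  hₗ = h (u (F.fromℕ (suc m)))
  regroup : ∀ d s P S h₀ hₗ → 2 * (d + P) + ((s + S) + h₀ + hₗ) ≡ (2 * d + s) + (2 * P + (S + hₗ)) + h₀
  regroup = solve-∀
  regroup′ : ∀ h₀ h₁ P S hₗ → (h₀ + h₁) + (2 * P + (S + hₗ)) + h₀ ≡ (2 * P + (S + h₁ + hₗ)) + 2 * h₀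
  regroup′ = solve-∀

gridPotential : ∀ a b → Vertex a b → ℕ
gridPotential a b v = potential (a ∸ 1) (b ∸ 1) (toPoint v)

gridSlack : ∀ a b → Vertex a b → Vertex a b → ℕ
gridSlack a b v w = slack (a ∸ 1) (b ∸ 1) (toPoint v) (toPoint w)

spread : ℕ → ℕ
spread n = sum (λ (x : Fin n) → fromCentre (n ∸ 1) (toℕ x))

total : ℕ → ℕ → ℕ
total a b = b * spread a + a * spread b

excess : ∀ a b m → (Fin (suc m) → Vertex a b) → ℕ
excess a b m u = pathSum (gridSlack a b) (suc m) u + gridPotential a b (u F.zero) + gridPotential a b (u (F.fromℕ m))

ordering-identity : ∀ a b m (u : Fin (suc m) → Vertex a b) → Ordering (suc m) u →
  2 * pathSum (gridDist {a} {b}) (suc m) u + excess a b m u ≡ 2 * total a b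
ordering-identity a b m u ord =
  trans (path-identity gridDist (gridSlack a b) (gridPotential a b) (λ v w → dist-slack (a ∸ 1) (b ∸ 1) (toPoint v) (toPoint w)) m u)
        (cong (2 *_) (trans (sum-bijection (gridPotential a b) u ord) (sum-separable a b (fromCentre (a ∸ 1)) (fromCentre (b ∸ 1)))))

-- Adding a point at both ends of a line of length n adds n + 1 twice to its spread.
spread-step : ∀ n → spread (suc (suc n)) ≡ spread n + 2 * suc n
spread-step n = begin
    spread (suc (suc n))
  ≡⟨⟩
    suc n + sum (λ (i : Fin (suc n)) → ∣ suc (dbl (toℕ i)) - n ∣)
  ≡⟨ cong (suc n +_) (sum-init-last (λ (i : Fin (suc n)) → ∣ suc (dbl (toℕ i)) - n ∣)) ⟩
    suc n + (sum (λ (i : Fin n) → ∣ suc (dbl (toℕ (F.inject₁ i))) - n ∣) + ∣ suc (dbl (toℕ (F.fromℕ n))) - n ∣)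
  ≡⟨ cong₂ (λ z w → suc n + (z + w))
       (sum-cong-≗ {n} (λ i → trans (cong (λ t → ∣ suc (dbl t) - n ∣) (FinP.toℕ-inject₁ i)) (inner n i)))
       (trans (cong (λ t → ∣ suc (dbl t) - n ∣) (FinP.toℕ-fromℕ n)) (outer n)) ⟩
    suc n + (spread n + suc n)
  ≡⟨ regroup (suc n) (spread n) ⟩
    spread n + 2 * suc n ∎
  where
  open ≡-Reasoning
  regroup : ∀ s q → s + (q + s) ≡ q + 2 * s
  regroup = solve-∀
  -- an inner point keeps its distance from the (unchanged) centre
  inner : ∀ n (i : Fin n) → ∣ suc (dbl (toℕ i)) - n ∣ ≡ fromCentre (n ∸ 1) (toℕ i)
  inner (suc n) i = refl
  outer : ∀ n → ∣ suc (dbl n) - n ∣ ≡ suc n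
  outer n = trans (m≤n⇒∣n-m∣≡n∸m (≤-trans (n≤dbl n) (n≤1+n _)))
                  (trans (+-∸-assoc 1 (n≤dbl n)) (cong suc (dbl∸ n)))

spread-even : ∀ p → spread (dbl p) ≡ 2 * p * p
spread-even zero = refl
spread-even (suc p) = begin
    spread (dbl (suc p))              ≡⟨ spread-step (dbl p) ⟩
    spread (dbl p) + 2 * suc (dbl p)  ≡⟨ cong₂ (λ z w → z + 2 * suc w) (spread-even p) (dbl≡2* p) ⟩
    2 * p * p + 2 * suc (2 * p)       ≡⟨ square p ⟩
    2 * suc p * suc p                 ∎
  where
  open ≡-Reasoning
  square : ∀ p → 2 * p * p + 2 * suc (2 * p) ≡ 2 * suc p * suc p
  square = solve-∀

spread-odd : ∀ p → spread (suc (dbl p)) ≡ 2 * p * suc p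
spread-odd zero = refl
spread-odd (suc p) = begin
    spread (suc (dbl (suc p)))                    ≡⟨ spread-step (suc (dbl p)) ⟩
    spread (suc (dbl p)) + 2 * suc (suc (dbl p))  ≡⟨ cong₂ (λ z w → z + 2 * suc (suc w)) (spread-odd p) (dbl≡2* p) ⟩
    2 * p * suc p + 2 * suc (suc (2 * p))         ≡⟨ pronic p ⟩
    2 * suc p * suc (suc p)                       ∎
  where
  open ≡-Reasoning
  pronic : ∀ p → 2 * p * suc p + 2 * suc (suc (2 * p)) ≡ 2 * suc p * suc (suc p)
  pronic = solve-∀

-- From 2P + K = 2T with K ≥ 2k - 1 we get P ≤ T - k: the parity rounds the bound.
halving-bound : ∀ {P K T} k → 2 * P + K ≡ 2 * T → 2 * k ≤ suc K → P ≤ T ∸ k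
halving-bound {P} {K} {T} k e k≤K with P + k ≤? T
... | yes P+k≤T = m+n≤o⇒m≤o∸n P P+k≤T
... | no P+k≰T = ⊥-elim (≤⇒≯ too-long (n<1+n (suc (2 * T))))
  where
  too-long : suc (suc (2 * T)) ≤ suc (2 * T)
  too-long = begin
    suc (suc (2 * T))  ≡⟨ *-suc 2 T ⟨
    2 * suc T          ≤⟨ *-monoʳ-≤ 2 (≰⇒> P+k≰T) ⟩
    2 * (P + k)        ≡⟨ *-distribˡ-+ 2 P k ⟩
    2 * P + 2 * k      ≤⟨ +-monoʳ-≤ (2 * P) k≤K ⟩
    2 * P + suc K      ≡⟨ +-suc (2 * P) K ⟩
    suc (2 * P + K)    ≡⟨ cong suc e ⟩
    suc (2 * T)        ∎
    where open ≤-Reasoning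

halving-exact : ∀ {P K T} k → 2 * P + K ≡ 2 * T → K ≡ 2 * k → P ≡ T ∸ k
halving-exact {P} {K} {T} k e K≡ = sym (trans (cong (_∸ k) (sym P+k≡T)) (m+n∸n≡m P k))
  where
  P+k≡T : P + k ≡ T
  P+k≡T = *-cancelˡ-≡ (P + k) T 2 (trans (*-distribˡ-+ 2 P k) (trans (cong (2 * P +_) (sym K≡)) e))

excess⇒upper-bound : ∀ a b k →
  (∀ m (u : Fin (suc (suc m)) → Vertex a b) → Ordering (suc (suc m)) u → 2 * k ≤ suc (excess a b (suc m) u)) →
  ∀ {n} (u : Fin n → Vertex a b) → Ordering n u → pathSum (gridDist {a} {b}) n u ≤ total a b ∸ k
excess⇒upper-bound a b k large {zero} u ord = z≤n
excess⇒upper-bound a b k large {suc zero} u ord = z≤n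
excess⇒upper-bound a b k large {suc (suc m)} u ord =
  halving-bound k (ordering-identity a b (suc m) u ord) (large m u ord)

-- On a side of even length the centre is not a grid point, so every point is away from it.
fromCentre-odd-positive : ∀ k x → 1 ≤ fromCentre (suc (dbl k)) x
fromCentre-odd-positive k x with fromCentre (suc (dbl k)) x in e
... | zero = ⊥-elim (dbl≢odd x k (∣m-n∣≡0⇒m≡n e))
... | suc _ = s≤s z≤n

fromCentre-even-zero : ∀ {p x} → fromCentre (dbl p) x ≡ 0 → x ≡ p
fromCentre-even-zero {p} {x} e = dbl-injective x p (∣m-n∣≡0⇒m≡n e)

below : ℕ → ℕ → Bool
below c x = does (dbl x <? c)

tight⇒switch : ∀ k x x' → ∣ dbl x - dbl x' ∣ ≡ fromCentre (suc (dbl k)) x + fromCentre (suc (dbl k)) x' →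
  below (suc (dbl k)) x ≡ not (below (suc (dbl k)) x')
tight⇒switch k x x' e with dbl x <? suc (dbl k) | dbl x' <? suc (dbl k)
... | yes lo | yes lo' = ⊥-elim (below⇒∣-∣-via-strict lo lo' e)
... | yes lo | no hi'  = trans (dec-true (dbl x <? _) lo) (cong not (sym (dec-false (dbl x' <? _) hi')))
... | no hi  | yes lo' = trans (dec-false (dbl x <? _) hi) (cong not (sym (dec-true (dbl x' <? _) lo')))
... | no hi  | no hi'  = ⊥-elim (above⇒∣-∣-via-strict (above x hi) (above x' hi') e)
  where
  above : ∀ z → ¬ (dbl z < suc (dbl k)) → suc (dbl k) < dbl z
  above z nz = ≤∧≢⇒< (ℕ.s≤s⁻¹ (≰⇒> nz)) (λ c≡ → dbl≢odd z k (sym c≡))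

not-xor-not : ∀ x y → not x xor not y ≡ x xor y
not-xor-not x y = trans (sym (not-distribˡ-xor x (not y))) (trans (cong not (sym (not-distribʳ-xor x y))) (not-involutive (x xor y)))

-- A slackless step switches sides in both coordinates and so keeps
-- the colour, but an ordering has to visit both colours: some step has slack.
module EvenEvenColouring (p q : ℕ) where
  a = dbl (suc p)
  b = dbl (suc q)

  colour : Vertex a b → Bool
  colour (x , y) = below (a ∸ 1) (toℕ x) xor below (b ∸ 1) (toℕ y)

  slackless-step-keeps-colour : ∀ v w → gridSlack a b v w ≡ 0 → colour v ≡ colour w
  slackless-step-keeps-colour (x , y) (x' , y') s≡0 =
    trans (cong₂ _xor_ (tight⇒switch p (toℕ x) (toℕ x') (proj₁ tight)) (tight⇒switch q (toℕ y) (toℕ y') (proj₂ tight)))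
          (not-xor-not (below (a ∸ 1) (toℕ x')) (below (b ∸ 1) (toℕ y')))
    where tight = slack-zero⇒tight (a ∸ 1) (b ∸ 1) (toℕ x) (toℕ y) (toℕ x') (toℕ y') s≡0

  slackless⇒monochrome : ∀ m (u : Fin (suc m) → Vertex a b) → pathSum (gridSlack a b) (suc m) u ≡ 0 →
    ∀ i → colour (u i) ≡ colour (u F.zero)
  slackless⇒monochrome m u S≡0 F.zero = refl
  slackless⇒monochrome (suc m) u S≡0 (F.suc i) =
    trans (slackless⇒monochrome m (u ∘ F.suc) (m+n≡0⇒n≡0 (gridSlack a b (u F.zero) (u (F.suc F.zero))) S≡0) i)
          (sym (slackless-step-keeps-colour (u F.zero) (u (F.suc F.zero)) (m+n≡0⇒m≡0 _ S≡0)))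

  corner₀ corner₁ : Vertex a b
  corner₀ = (F.zero , F.zero)
  corner₁ = (F.zero , F.fromℕ (suc (dbl q)))

  colour-corner₀ : colour corner₀ ≡ false
  colour-corner₀ = cong₂ _xor_ (dec-true (0 <? a ∸ 1) (s≤s z≤n)) (dec-true (0 <? b ∸ 1) (s≤s z≤n))

  colour-corner₁ : colour corner₁ ≡ true
  colour-corner₁ = cong₂ _xor_ (dec-true (0 <? a ∸ 1) (s≤s z≤n))
    (trans (cong (below (b ∸ 1)) (FinP.toℕ-fromℕ (suc (dbl q)))) (dec-false (dbl (suc (dbl q)) <? b ∸ 1) not-below))
    where
    not-below : ¬ (dbl (suc (dbl q)) < suc (dbl q))
    not-below = ≤⇒≯ (n≤dbl (suc (dbl q)))

  -- Without slack, the two corners would both get the colour of the first vertex.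
  ordering-has-slack : ∀ m (u : Fin (suc m) → Vertex a b) → Ordering (suc m) u → 1 ≤ pathSum (gridSlack a b) (suc m) u
  ordering-has-slack m u (_ , onto) with pathSum (gridSlack a b) (suc m) u in S≡
  ... | suc _ = s≤s z≤n
  ... | zero with trans (sym colour-corner₀) (trans (reached corner₀) (sym (trans (sym colour-corner₁) (reached corner₁))))
    where
    reached : ∀ v → colour v ≡ colour (u F.zero)
    reached v = trans (cong colour (sym (proj₂ (onto v) refl))) (slackless⇒monochrome m u S≡ (proj₁ (onto v)))
  ... | ()

  -- Every vertex has potential at least 2, and some step has slack: excess ≥ 5.
  excess-bound : ∀ m (u : Fin (suc (suc m)) → Vertex a b) → Ordering (suc (suc m)) u → 2 * 3 ≤ suc (excess a b (suc m) u)
  excess-bound m u ord = s≤s (+-mono-≤ (+-mono-≤ (ordering-has-slack (suc m) u ord) (potential≥2 (u F.zero))) (potential≥2 (u (F.fromℕ (suc m)))))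
    where
    potential≥2 : ∀ v → 2 ≤ gridPotential a b v
    potential≥2 (x , y) = +-mono-≤ (fromCentre-odd-positive p (toℕ x)) (fromCentre-odd-positive q (toℕ y))

ends≤excess : ∀ a b m (u : Fin (suc m) → Vertex a b) →
  gridPotential a b (u F.zero) + gridPotential a b (u (F.fromℕ m)) ≤ excess a b m u
ends≤excess a b m u = +-monoˡ-≤ (gridPotential a b (u (F.fromℕ m))) (m≤n+m _ (pathSum (gridSlack a b) (suc m) u))

-- One side even: the first vertex has positive potential, so excess ≥ 1.
excess-bound-even-side : ∀ p b m (u : Fin (suc (suc m)) → Vertex (dbl (suc p)) b) → 2 * 1 ≤ suc (excess (dbl (suc p)) b (suc m) u)
excess-bound-even-side p b m u = s≤s (≤-trans (≤-trans first-positive (m≤m+n _ _)) (ends≤excess (dbl (suc p)) b (suc m) u))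
  where
  first-positive : 1 ≤ gridPotential (dbl (suc p)) b (u F.zero)
  first-positive = ≤-trans (fromCentre-odd-positive p (toℕ (proj₁ (u F.zero)))) (m≤m+n _ _)

-- Both sides odd: only the centre has potential zero, and the two ends of an
-- ordering of at least two vertices differ, so excess ≥ 1.
excess-bound-odd-odd : ∀ p q m (u : Fin (suc (suc m)) → Vertex (suc (dbl p)) (suc (dbl q))) → Ordering (suc (suc m)) u →
  2 * 1 ≤ suc (excess (suc (dbl p)) (suc (dbl q)) (suc m) u)
excess-bound-odd-odd p q m u (one-to-one , _) = s≤s (≤-trans ends-positive (ends≤excess _ _ (suc m) u))
  where
  h = gridPotential (suc (dbl p)) (suc (dbl q))
  centre : ∀ {v} → h v ≡ 0 → toPoint v ≡ (p , q)
  centre {x , y} e = cong₂ _,_ (fromCentre-even-zero (m+n≡0⇒m≡0 _ e)) (fromCentre-even-zero (m+n≡0⇒n≡0 (fromCentre (dbl p) (toℕ x)) e))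
  ends-positive : 1 ≤ h (u F.zero) + h (u (F.fromℕ (suc m)))
  ends-positive with h (u F.zero) in e₀ | h (u (F.fromℕ (suc m))) in eₗ
  ... | suc _ | _ = s≤s z≤n
  ... | zero | suc _ = s≤s z≤n
  ... | zero | zero with one-to-one (toPoint-injective (trans (centre e₀) (sym (centre eₗ))))
    where
    toPoint-injective : ∀ {v w : Vertex (suc (dbl p)) (suc (dbl q))} → toPoint v ≡ toPoint w → v ≡ w
    toPoint-injective {x , y} {x' , y'} e = cong₂ _,_ (FinP.toℕ-injective (cong proj₁ e)) (FinP.toℕ-injective (cong proj₂ e))
  ... | ()

injective⇒onto : ∀ n (g : Fin n → Fin n) → Injective _≡_ _≡_ g → ∀ y → ∃ λ x → g x ≡ y
injective⇒onto n g inj y with FinP.any? (λ x → g x FinP.≟ y)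
... | yes found = found
injective⇒onto (suc n) g inj y | no missed = ⊥-elim (<-irrefl refl (FinP.injective⇒≤ squeezed-injective))
  where
  -- if y is missed, g squeezes Fin (suc n) injectively into Fin n
  avoids : ∀ x → y ≢ g x
  avoids x e = missed (x , sym e)
  squeezed-injective : Injective _≡_ _≡_ (λ x → F.punchOut (avoids x))
  squeezed-injective {x} {x'} e = inj (FinP.punchOut-injective (avoids x) (avoids x') e)

onto⇒ordering : ∀ {a b} (u : Fin (a * b) → Vertex a b) → (∀ v → ∃ λ i → u i ≡ v) → Ordering (a * b) u
onto⇒ordering {a} {b} u onto = one-to-one , (λ v → proj₁ (onto v) , λ { refl → proj₂ (onto v) })
  where
  -- a section of u, read through remQuot; it is injective, hence onto
  section : Fin (a * b) → Fin (a * b)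
  section k = proj₁ (onto (remQuot b k))
  remQuot-injective : ∀ {k k'} → remQuot {a} b k ≡ remQuot b k' → k ≡ k'
  remQuot-injective {k} {k'} e = trans (sym (FinP.combine-remQuot {a} b k)) (trans (cong (uncurry combine) e) (FinP.combine-remQuot {a} b k'))
  section-injective : Injective _≡_ _≡_ section
  section-injective {k} {k'} e = remQuot-injective (trans (sym (proj₂ (onto (remQuot b k)))) (trans (cong u e) (proj₂ (onto (remQuot b k')))))
  one-to-one : Injective _≡_ _≡_ u
  one-to-one {i} {j} e with injective⇒onto (a * b) section section-injective i | injective⇒onto (a * b) section section-injective j
  ... | k , refl | k' , refl = cong section (remQuot-injective
        (trans (sym (proj₂ (onto (remQuot b k)))) (trans e (proj₂ (onto (remQuot b k'))))))

lastOf : Point → List Point → Point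
lastOf v [] = v
lastOf v (w ∷ L) = lastOf w L

lastOf-All : ∀ {P : Point → Set} v L → All P (v ∷ L) → P (lastOf v L)
lastOf-All v [] (pv ∷ _) = pv
lastOf-All v (w ∷ L) (_ ∷ rest) = lastOf-All w L rest

chain : (Point → Point → ℕ) → List Point → ℕ
chain f [] = 0
chain f (v ∷ []) = 0
chain f (v ∷ w ∷ L) = f v w + chain f (w ∷ L)

InGrid : ℕ → ℕ → Point → Set
InGrid a b (x , y) = x < a × y < b

-- Reading a number as an element of Fin (suc n); faithful below suc n.
toFin : ∀ n → ℕ → Fin (suc n)
toFin n x with x <? suc n
... | yes x<n = F.fromℕ< x<n
... | no _ = F.zero

toℕ-toFin : ∀ n x → x < suc n → toℕ (toFin n x) ≡ x
toℕ-toFin n x x<n with x <? suc n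
... | yes x<n′ = FinP.toℕ-fromℕ< x<n′
... | no x≮n = ⊥-elim (x≮n x<n)

module Listed (a' b' : ℕ) where
  a = suc a'
  b = suc b'

  toVertex : Point → Vertex a b
  toVertex (x , y) = (toFin a' x , toFin b' y)

  toPoint-toVertex : ∀ v → InGrid a b v → toPoint (toVertex v) ≡ v
  toPoint-toVertex (x , y) (x<a , y<b) = cong₂ _,_ (toℕ-toFin a' x x<a) (toℕ-toFin b' y y<b)

  pathSum-chain : ∀ (f : Vertex a b → Vertex a b → ℕ) (g : Point → Point → ℕ) →
    (∀ v w → InGrid a b v → InGrid a b w → f (toVertex v) (toVertex w) ≡ g v w) →
    ∀ v L → All (InGrid a b) (v ∷ L) → pathSum f (length (v ∷ L)) (toVertex ∘ lookup (v ∷ L)) ≡ chain g (v ∷ L)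
  pathSum-chain f g f≡g v [] _ = refl
  pathSum-chain f g f≡g v (w ∷ L) (v∈ ∷ w∈ ∷ rest) = cong₂ _+_ (f≡g v w v∈ w∈) (pathSum-chain f g f≡g w L (w∈ ∷ rest))

  lookup-last : ∀ v L → lookup (v ∷ L) (F.fromℕ (length L)) ≡ lastOf v L
  lookup-last v [] = refl
  lookup-last v (w ∷ L) = lookup-last w L

  list⇒ordering : ∀ k v L → length (v ∷ L) ≡ a * b → All (InGrid a b) (v ∷ L) →
    (∀ x y → InGrid a b (x , y) → (x , y) ∈ v ∷ L) →
    chain (slack a' b') (v ∷ L) + potential a' b' v + potential a' b' (lastOf v L) ≡ 2 * k →
    Σ (Fin (a * b) → Vertex a b) λ u → Ordering (a * b) u × pathSum (gridDist {a} {b}) (a * b) u ≡ total a b ∸ k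
  list⇒ordering k v L len inGrid listed excess≡ =
    subst (λ n → Σ (Fin n → Vertex a b) λ u → Ordering n u × pathSum (gridDist {a} {b}) n u ≡ total a b ∸ k)
          len (u , ordering , halving-exact k (ordering-identity a b (length L) u ordering) (trans same-excess excess≡))
    where
    u : Fin (length (v ∷ L)) → Vertex a b
    u = toVertex ∘ lookup (v ∷ L)
    onto : ∀ w → ∃ λ i → u i ≡ w
    onto (x , y) = index w∈ , trans (cong toVertex (sym (lookup-index w∈)))
                                     (cong₂ _,_ (FinP.toℕ-injective (toℕ-toFin a' (toℕ x) (FinP.toℕ<n x)))
                                                (FinP.toℕ-injective (toℕ-toFin b' (toℕ y) (FinP.toℕ<n y))))
      where w∈ = listed (toℕ x) (toℕ y) (FinP.toℕ<n x , FinP.toℕ<n y)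
    ordering : Ordering (length (v ∷ L)) u
    ordering = subst (λ n → (u : Fin n → Vertex a b) → (∀ w → ∃ λ i → u i ≡ w) → Ordering n u) (sym len) onto⇒ordering u onto
    same-excess : excess a b (length L) u ≡ chain (slack a' b') (v ∷ L) + potential a' b' v + potential a' b' (lastOf v L)
    same-excess = cong₂ _+_ (cong₂ _+_
      (pathSum-chain (gridSlack a b) (slack a' b') (λ v w v∈ w∈ → cong₂ (slack a' b') (toPoint-toVertex v v∈) (toPoint-toVertex w w∈)) v L inGrid)
      (cong (potential a' b') (toPoint-toVertex v (All.head inGrid))))
      (cong (potential a' b') (trans (cong (toPoint ∘ toVertex) (lookup-last v L)) (toPoint-toVertex (lastOf v L) (lastOf-All v L inGrid))))

chain-zero : ∀ {R : Point → Point → Set} (f : Point → Point → ℕ) → (∀ {v w} → R v w → f v w ≡ 0) →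
  ∀ {L} → Linked R L → chain f L ≡ 0
chain-zero f zero-on-R [] = refl
chain-zero f zero-on-R [-] = refl
chain-zero f zero-on-R (r ∷ rest) = cong₂ _+_ (zero-on-R r) (chain-zero f zero-on-R rest)

chain-++ : ∀ f x xs y ys → chain f (x ∷ xs ++ y ∷ ys) ≡ chain f (x ∷ xs) + f (lastOf x xs) y + chain f (y ∷ ys)
chain-++ f x [] y ys = refl
chain-++ f x (x' ∷ xs) y ys = trans (cong (f x x' +_) (chain-++ f x' xs y ys)) (regroup (f x x') _ _ _)
  where
  regroup : ∀ p q r t → p + (q + r + t) ≡ p + q + r + t
  regroup = solve-∀

lastOf-++ : ∀ x xs y ys → lastOf x (xs ++ y ∷ ys) ≡ lastOf y ys
lastOf-++ x [] y ys = refl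
lastOf-++ x (x' ∷ xs) y ys = lastOf-++ x' xs y ys

Linked-all : ∀ {Q : Point → Set} {R : Point → Point → Set} → (∀ {v w} → Q v → Q w → R v w) →
  ∀ {L} → All Q L → Linked R L
Linked-all related [] = []
Linked-all related (_ ∷ []) = [-]
Linked-all related (q ∷ q' ∷ qs) = related q q' ∷ Linked-all related (q' ∷ qs)

pairs : (Point → Point) → (Point → Point) → List Point → List Point
pairs f g [] = []
pairs f g (w ∷ ws) = f w ∷ g w ∷ pairs f g ws

pairs-++ : ∀ f g xs ys → pairs f g (xs ++ ys) ≡ pairs f g xs ++ pairs f g ys
pairs-++ f g [] ys = refl
pairs-++ f g (x ∷ xs) ys = cong (λ z → f x ∷ g x ∷ z) (pairs-++ f g xs ys)

length-pairs : ∀ f g W → length (pairs f g W) ≡ 2 * length W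
length-pairs f g [] = refl
length-pairs f g (w ∷ W) = trans (cong (suc ∘ suc) (length-pairs f g W)) (sym (*-suc 2 (length W)))

∈-pairs : ∀ f g {w} W → w ∈ W → (f w ∈ pairs f g W) × (g w ∈ pairs f g W)
∈-pairs f g (w ∷ W) (here refl) = here refl , there (here refl)
∈-pairs f g (w ∷ W) (there w∈) = there (there (proj₁ rest)) , there (there (proj₂ rest))
  where rest = ∈-pairs f g W w∈

All-pairs : ∀ {Q : Point → Set} f g {W} → (∀ {w} → Q w → Q (f w)) → (∀ {w} → Q w → Q (g w)) → All Q W → All Q (pairs f g W)
All-pairs f g Qf Qg [] = []
All-pairs f g Qf Qg (q ∷ qs) = Qf q ∷ Qg q ∷ All-pairs f g Qf Qg qs

Linked-pairs : ∀ {Q : Point → Set} {R Z : Point → Point → Set} f g →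
  (∀ {w} → Q w → Z (f w) (g w)) → (∀ {v w} → Q v → Q w → R v w → Z (g v) (f w)) →
  ∀ {W} → All Q W → Linked R W → Linked Z (pairs f g W)
Linked-pairs f g within between [] [] = []
Linked-pairs f g within between (q ∷ []) [-] = within q ∷ [-]
Linked-pairs f g within between (q ∷ q' ∷ qs) (r ∷ rs) = within q ∷ between q q' r ∷ Linked-pairs f g within between (q' ∷ qs) rs

lastOf-pairs : ∀ (g : Point → Point) x xs → lastOf x (g x ∷ pairs id g xs) ≡ g (lastOf x xs)
lastOf-pairs g x [] = refl
lastOf-pairs g x (y ∷ xs) = lastOf-pairs g y xs

row : ℕ → ℕ → ℕ → List Point
row y x₀ zero = []
row y x₀ (suc k) = (x₀ , y) ∷ row y (suc x₀) k

block : ℕ → ℕ → ℕ → List Point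
block y₀ zero n = []
block y₀ (suc k) n = row y₀ 0 n ++ block (suc y₀) k n

length-row : ∀ y x₀ k → length (row y x₀ k) ≡ k
length-row y x₀ zero = refl
length-row y x₀ (suc k) = cong suc (length-row y (suc x₀) k)

length-block : ∀ y₀ k n → length (block y₀ k n) ≡ k * n
length-block y₀ zero n = refl
length-block y₀ (suc k) n = trans (length-++ (row y₀ 0 n)) (cong₂ _+_ (length-row y₀ 0 n) (length-block (suc y₀) k n))

lastOf-row : ∀ y x₀ k → lastOf (x₀ , y) (row y (suc x₀) k) ≡ (x₀ + k , y)
lastOf-row y x₀ zero = cong (_, y) (sym (+-identityʳ x₀))
lastOf-row y x₀ (suc k) = trans (lastOf-row y (suc x₀) k) (cong (_, y) (sym (+-suc x₀ k)))

∈-row : ∀ y x₀ k x → x₀ ≤ x → x < x₀ + k → (x , y) ∈ row y x₀ k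
∈-row y x₀ zero x x₀≤x x<x₀+k = ⊥-elim (<⇒≱ (subst (x <_) (+-identityʳ x₀) x<x₀+k) x₀≤x)
∈-row y x₀ (suc k) x x₀≤x x<x₀+k with x₀ ℕ.≟ x
... | yes refl = here refl
... | no x₀≢x = there (∈-row y (suc x₀) k x (≤∧≢⇒< x₀≤x x₀≢x) (subst (x <_) (+-suc x₀ k) x<x₀+k))

∈-block : ∀ y₀ k n x y → x < n → y₀ ≤ y → y < y₀ + k → (x , y) ∈ block y₀ k n
∈-block y₀ zero n x y x<n y₀≤y y<y₀+k = ⊥-elim (<⇒≱ (subst (y <_) (+-identityʳ y₀) y<y₀+k) y₀≤y)
∈-block y₀ (suc k) n x y x<n y₀≤y y<y₀+k with y₀ ℕ.≟ y
... | yes refl = ∈-++⁺ˡ (∈-row y₀ 0 n x z≤n x<n)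
... | no y₀≢y = ∈-++⁺ʳ (row y₀ 0 n) (∈-block (suc y₀) k n x y x<n (≤∧≢⇒< y₀≤y y₀≢y) (subst (y <_) (+-suc y₀ k) y<y₀+k))

All-row : ∀ {Q : Point → Set} y x₀ k → (∀ x → x₀ ≤ x → x < x₀ + k → Q (x , y)) → All Q (row y x₀ k)
All-row y x₀ zero Q-row = []
All-row y x₀ (suc k) Q-row = Q-row x₀ ≤-refl (subst (x₀ <_) (sym (+-suc x₀ k)) (s≤s (m≤m+n x₀ k))) ∷
  All-row y (suc x₀) k (λ x x₀<x x<end → Q-row x (<⇒≤ x₀<x) (subst (x <_) (sym (+-suc x₀ k)) x<end))

All-block : ∀ {Q : Point → Set} y₀ k n → (∀ x y → x < n → y₀ ≤ y → y < y₀ + k → Q (x , y)) → All Q (block y₀ k n)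
All-block y₀ zero n Q-block = []
All-block y₀ (suc k) n Q-block =
  All++⁺ (All-row y₀ 0 n (λ x _ x<n → Q-block x y₀ x<n ≤-refl (subst (y₀ <_) (sym (+-suc y₀ k)) (s≤s (m≤m+n y₀ k)))))
         (All-block (suc y₀) k n (λ x y x<n y₀<y y<end → Q-block x y x<n (<⇒≤ y₀<y) (subst (y <_) (sym (+-suc y₀ k)) y<end)))

mirror-below : ∀ {m n c} → m + n ≡ c + c → n ≤ c → c ≤ m
mirror-below {m} {n} {c} e n≤c = +-cancelʳ-≤ c c m (subst (_≤ m + c) e (+-monoʳ-≤ m n≤c))

mirror-above : ∀ {m n c} → m + n ≡ c + c → c ≤ n → m ≤ c
mirror-above {m} {n} {c} e c≤n = +-cancelʳ-≤ n m c (subst (_≤ c + n) (sym e) (+-monoʳ-≤ c c≤n))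

mirror-fromCentre : ∀ m n c → m + n ≡ c + c → ∣ m - c ∣ ≡ ∣ n - c ∣
mirror-fromCentre m n c e = begin
  ∣ m - c ∣              ≡⟨ ∣m+n-m+o∣≡∣n-o∣ n m c ⟨
  ∣ n + m - n + c ∣      ≡⟨ cong₂ ∣_-_∣ (trans (+-comm n m) e) (+-comm n c) ⟩
  ∣ c + c - c + n ∣      ≡⟨ ∣m+n-m+o∣≡∣n-o∣ c c n ⟩
  ∣ c - n ∣              ≡⟨ ∣-∣-comm c n ⟩
  ∣ n - c ∣              ∎
  where open ≡-Reasoning

mirror-opposite : ∀ {m n c} → m + n ≡ c + c → Opposite c n m
mirror-opposite {m} {n} {c} e with ≤-total n c
... | inj₁ n≤c = inj₁ (n≤c , mirror-below e n≤c)
... | inj₂ c≤n = inj₂ (mirror-above e c≤n , c≤n)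

-- In doubled coordinates, c - x is the mirror image of x in the centre c.
dbl-mirror : ∀ c x → x ≤ c → dbl (c ∸ x) + dbl x ≡ c + c
dbl-mirror c x x≤c = trans (sym (dbl-+ (c ∸ x) x)) (trans (cong dbl (m∸n+n≡m x≤c)) (dbl≡+ c))

SameSide : ℕ → ℕ → ℕ → Set
SameSide c X Y = (X ≤ c × Y ≤ c) ⊎ (c ≤ X × c ≤ Y)

mirror-opposite-same-side : ∀ c x Y → x ≤ c → SameSide c (dbl x) Y → Opposite c (dbl (c ∸ x)) Y
mirror-opposite-same-side c x Y x≤c (inj₁ (lo , Y≤c)) = inj₂ (Y≤c , mirror-below (dbl-mirror c x x≤c) lo)
mirror-opposite-same-side c x Y x≤c (inj₂ (hi , c≤Y)) = inj₁ (mirror-above (dbl-mirror c x x≤c) hi , c≤Y)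

Opposite-sym : ∀ {c X Y} → Opposite c X Y → Opposite c Y X
Opposite-sym (inj₁ p) = inj₂ p
Opposite-sym (inj₂ p) = inj₁ p

SameSide-sym : ∀ {c X Y} → SameSide c X Y → SameSide c Y X
SameSide-sym (inj₁ (p , q)) = inj₁ (q , p)
SameSide-sym (inj₂ (p , q)) = inj₂ (q , p)

-- The central reflection ρ of the grid with doubled centre (a', b') and the steps
-- it makes slackless.  The constructions walk through one half H of the grid and
-- alternate each vertex with its mirror image.
module Reflection (a' b' : ℕ) where
  A = suc a'
  B = suc b'
  s = slack a' b'
  h = potential a' b'

  ρ : Point → Point
  ρ (x , y) = (a' ∸ x , b' ∸ y)

  InGrid-ρ : ∀ {v} → InGrid A B v → InGrid A B (ρ v)
  InGrid-ρ {x , y} _ = s≤s (m∸n≤m a' x) , s≤s (m∸n≤m b' y)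

  ρ-involutive : ∀ v → InGrid A B v → ρ (ρ v) ≡ v
  ρ-involutive (x , y) (x<A , y<B) = cong₂ _,_ (m∸[m∸n]≡n (ℕ.s≤s⁻¹ x<A)) (m∸[m∸n]≡n (ℕ.s≤s⁻¹ y<B))

  potential-ρ : ∀ v → InGrid A B v → h (ρ v) ≡ h v
  potential-ρ (x , y) (x<A , y<B) = cong₂ _+_ (mirror-fromCentre (dbl (a' ∸ x)) (dbl x) a' (dbl-mirror a' x (ℕ.s≤s⁻¹ x<A)))
                                              (mirror-fromCentre (dbl (b' ∸ y)) (dbl y) b' (dbl-mirror b' y (ℕ.s≤s⁻¹ y<B)))

  LeftHalf : Point → Set
  LeftHalf v = InGrid A B v × (dbl (proj₁ v) ≤ a')

  SameSideY : Point → Point → Set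
  SameSideY v w = SameSide b' (dbl (proj₂ v)) (dbl (proj₂ w))

  Slackless : Point → Point → Set
  Slackless v w = s v w ≡ 0

  slackless-mirror : ∀ {w} → InGrid A B w → Slackless w (ρ w)
  slackless-mirror {x , y} (x<A , y<B) = slack-zero a' b' x y (a' ∸ x) (b' ∸ y)
    (mirror-opposite (dbl-mirror a' x (ℕ.s≤s⁻¹ x<A))) (mirror-opposite (dbl-mirror b' y (ℕ.s≤s⁻¹ y<B)))

  slackless-mirror′ : ∀ {w} → InGrid A B w → Slackless (ρ w) w
  slackless-mirror′ {x , y} (x<A , y<B) = slack-zero a' b' (a' ∸ x) (b' ∸ y) x y
    (Opposite-sym (mirror-opposite (dbl-mirror a' x (ℕ.s≤s⁻¹ x<A)))) (Opposite-sym (mirror-opposite (dbl-mirror b' y (ℕ.s≤s⁻¹ y<B))))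

  slackless-across : ∀ {v w} → LeftHalf v → LeftHalf w → SameSideY v w → Slackless (ρ v) w
  slackless-across {x , y} {x' , y'} ((x<A , y<B) , left) (_ , left') same =
    slack-zero a' b' (a' ∸ x) (b' ∸ y) x' y'
      (mirror-opposite-same-side a' x (dbl x') (ℕ.s≤s⁻¹ x<A) (inj₁ (left , left')))
      (mirror-opposite-same-side b' y (dbl y') (ℕ.s≤s⁻¹ y<B) same)

  slackless-across′ : ∀ {v w} → LeftHalf v → LeftHalf w → SameSideY v w → Slackless v (ρ w)
  slackless-across′ {x , y} {x' , y'} (_ , left) ((x'<A , y'<B) , left') same =
    slack-zero a' b' x y (a' ∸ x') (b' ∸ y')
      (Opposite-sym (mirror-opposite-same-side a' x' (dbl x) (ℕ.s≤s⁻¹ x'<A) (inj₁ (left' , left))))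
      (Opposite-sym (mirror-opposite-same-side b' y' (dbl y) (ℕ.s≤s⁻¹ y'<B) (SameSide-sym same)))

  Lower Upper : Point → Set
  Lower v = dbl (proj₂ v) ≤ b'
  Upper v = b' ≤ dbl (proj₂ v)

  Linked-lower-upper : ∀ x xs ys → All Lower (x ∷ xs) → All Upper ys → Upper (lastOf x xs) → Linked SameSideY (x ∷ xs ++ ys)
  Linked-lower-upper x [] [] _ _ _ = [-]
  Linked-lower-upper x [] (y ∷ ys) _ (up ∷ ups) x-up = inj₂ (x-up , up) ∷ Linked-all (λ p q → inj₂ (p , q)) (up ∷ ups)
  Linked-lower-upper x (x' ∷ xs) ys (lo ∷ lo' ∷ los) ups last-up = inj₁ (lo , lo') ∷ Linked-lower-upper x' xs ys (lo' ∷ los) ups last-up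

  SameSideY-centre : ∀ v c → dbl (proj₂ c) ≡ b' → SameSideY v c
  SameSideY-centre (x , y) c e with ≤-total (dbl y) b'
  ... | inj₁ lo = inj₁ (lo , ≤-reflexive e)
  ... | inj₂ hi = inj₂ (hi , ≤-reflexive (sym e))

  covers-by-halves : ∀ P (M L : List Point) → (∀ {x} → ¬ (x < P) → a' ∸ x < P) →
    (∀ x y → x < P → y < B → (x , y) ∈ M) → (∀ {v} → v ∈ M → v ∈ L × ρ v ∈ L) →
    ∀ x y → InGrid A B (x , y) → (x , y) ∈ L
  covers-by-halves P M L mirror-left ∈M ∈L x y (x<A , y<B) with x <? P
  ... | yes x<P = proj₁ (∈L (∈M x y x<P y<B))
  ... | no x≮P = subst (_∈ L) (ρ-involutive (x , y) (x<A , y<B)) (proj₂ (∈L (∈M (a' ∸ x) (b' ∸ y) (mirror-left x≮P) (proj₂ (InGrid-ρ (x<A , y<B))))))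

  chain-pairs-mirror : ∀ {W} → All LeftHalf W → Linked SameSideY W → chain s (pairs id ρ W) ≡ 0
  chain-pairs-mirror left linked = chain-zero s id (Linked-pairs id ρ (λ l → slackless-mirror (proj₁ l)) slackless-across left linked)

∣n-1+n∣≡1 : ∀ n → ∣ n - suc n ∣ ≡ 1
∣n-1+n∣≡1 zero = refl
∣n-1+n∣≡1 (suc n) = ∣n-1+n∣≡1 n

∣1+n-n∣≡1 : ∀ n → ∣ suc n - n ∣ ≡ 1
∣1+n-n∣≡1 n = trans (∣-∣-comm (suc n) n) (∣n-1+n∣≡1 n)

-- A side of even length 2p + 4 (doubled centre a' = 2p + 3): the columns x < p + 2
-- form its left half, and every other column mirrors into them.
module EvenWidth (p : ℕ) where
  P = suc (suc p)
  a' = suc (dbl (suc p))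

  left-x : ∀ {x} → x < P → dbl x ≤ a'
  left-x x<P = ≤-trans (dbl-mono (ℕ.s≤s⁻¹ x<P)) (n≤1+n _)

  grid-x : ∀ {x} → x < P → x < suc a'
  grid-x x<P = ≤-trans x<P (s≤s (s≤s (≤-trans (n≤1+n p) (n≤dbl (suc p)))))

  mirror-left : ∀ {x} → ¬ (x < P) → a' ∸ x < P
  mirror-left x≮P = s≤s (≤-trans (∸-monoʳ-≤ a' (ℕ.s≤s⁻¹ (≰⇒> x≮P))) (≤-reflexive (dbl∸ (suc p))))

-- a = 2p + 4 even, b = 2q + 1 odd; the left half consists of the columns x < p + 2.
-- Start at c₀ = (p + 1, q) next to the centre, visit ρ w, w for every remaining w of
-- the left half (lower rows, the centre row up to x = p, upper rows) and end at ρ c₀.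
-- Every step is slackless and both ends have potential 1, so the excess is 2.
module EvenOddTour (p q : ℕ) where
  open EvenWidth p public
  b' = dbl q
  open Reflection a' b' public

  c₀ : Point
  c₀ = (suc p , q)

  lower upper W tour : List Point
  lower = block 0 q P ++ row q 0 (suc p)
  upper = block (suc q) q P
  W = lower ++ upper
  tour = pairs ρ id W ++ ρ c₀ ∷ []

  left-c₀ : LeftHalf c₀
  left-c₀ = (grid-x (n<1+n (suc p)) , s≤s (n≤dbl q)) , left-x (n<1+n (suc p))

  left-W : All LeftHalf W
  left-W = All++⁺ (All++⁺
     (All-block 0 q P (λ x y x<P _ y<q → (grid-x x<P , ≤-trans y<q (≤-trans (n≤dbl q) (n≤1+n _))) , left-x x<P))
     (All-row q 0 (suc p) (λ x _ x≤p → (grid-x (≤-trans x≤p (n≤1+n _)) , s≤s (n≤dbl q)) , left-x (≤-trans x≤p (n≤1+n _)))))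
     (All-block (suc q) q P (λ x y x<P _ y<2q+1 → (grid-x x<P , subst (y <_) (cong suc (sym (dbl≡+ q))) y<2q+1) , left-x x<P))

  linked-W : Linked SameSideY (c₀ ∷ W)
  linked-W = Linked-lower-upper c₀ lower upper
    (≤-refl ∷ All++⁺ (All-block 0 q P (λ x y _ _ y<q → dbl-mono (<⇒≤ y<q))) (All-row q 0 (suc p) (λ _ _ _ → ≤-refl)))
    (All-block (suc q) q P (λ x y _ q<y _ → dbl-mono (<⇒≤ q<y)))
    (subst Upper (sym (lastOf-++ c₀ (block 0 q P) (0 , q) (row q 1 p)))
       (lastOf-All {Upper} (0 , q) (row q 1 p) (≤-refl ∷ All-row q 1 p (λ _ _ _ → ≤-refl))))

  slackless-tour : ∀ x W → LeftHalf x → All LeftHalf W → Linked SameSideY (x ∷ W) → SameSideY (lastOf x W) c₀ →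
    Linked Slackless (x ∷ pairs ρ id W ++ ρ c₀ ∷ [])
  slackless-tour x [] left-x _ _ last = slackless-across′ left-x left-c₀ last ∷ [-]
  slackless-tour x (w ∷ W) left-x (left-w ∷ lefts) (same ∷ linked) last =
    slackless-across′ left-x left-w same ∷ slackless-mirror′ (proj₁ left-w) ∷ slackless-tour w W left-w lefts linked last

  chain-tour : chain s (c₀ ∷ tour) ≡ 0
  chain-tour = chain-zero s id (slackless-tour c₀ W left-c₀ left-W linked-W (SameSideY-centre (lastOf c₀ W) c₀ refl))

  potential-c₀ : h c₀ ≡ 1
  potential-c₀ = cong₂ _+_ (∣n-1+n∣≡1 (dbl (suc p))) (∣n-n∣≡0 (dbl q))

  potential-last : h (lastOf c₀ tour) ≡ 1
  potential-last = trans (cong h (lastOf-++ c₀ (pairs ρ id W) (ρ c₀) [])) (trans (potential-ρ c₀ (proj₁ left-c₀)) potential-c₀)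

  in-grid : All (InGrid A B) (c₀ ∷ tour)
  in-grid = proj₁ left-c₀ ∷ All++⁺ (All-pairs ρ id InGrid-ρ id (All.map proj₁ left-W)) (InGrid-ρ (proj₁ left-c₀) ∷ [])

  length-tour : length (c₀ ∷ tour) ≡ A * B
  length-tour = begin
      suc (length (pairs ρ id W ++ ρ c₀ ∷ []))
    ≡⟨ cong suc (length-++ (pairs ρ id W)) ⟩
      suc (length (pairs ρ id W) + 1)
    ≡⟨ cong (λ z → suc (z + 1)) (trans (length-pairs ρ id W) (cong (2 *_) length-W)) ⟩
      suc (2 * (q * P + suc p + q * P) + 1)
    ≡⟨ count p q ⟩
      suc (suc (2 * suc p)) * suc (2 * q)
    ≡⟨ cong₂ (λ z w → suc (suc z) * suc w) (sym (dbl≡2* (suc p))) (sym (dbl≡2* q)) ⟩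
      A * B ∎
    where
    open ≡-Reasoning
    length-W : length W ≡ q * P + suc p + q * P
    length-W = trans (length-++ lower) (cong₂ _+_
      (trans (length-++ (block 0 q P)) (cong₂ _+_ (length-block 0 q P) (length-row q 0 (suc p))))
      (length-block (suc q) q P))
    count : ∀ p q → suc (2 * (q * suc (suc p) + suc p + q * suc (suc p)) + 1) ≡ suc (suc (2 * suc p)) * suc (2 * q)
    count = solve-∀

  ∈-left : ∀ x y → x < P → y < B → (x , y) ∈ c₀ ∷ W
  ∈-left x y x<P y<B with <-cmp y q
  ... | tri< y<q _ _ = there (∈-++⁺ˡ (∈-++⁺ˡ (∈-block 0 q P x y x<P z≤n y<q)))
  ... | tri> _ _ q<y = there (∈-++⁺ʳ lower (∈-block (suc q) q P x y x<P q<y (subst (y <_) (cong suc (dbl≡+ q)) y<B)))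
  ... | tri≈ _ refl _ with x ℕ.≟ suc p
  ...   | yes refl = here refl
  ...   | no x≢p+1 = there (∈-++⁺ˡ (∈-++⁺ʳ (block 0 q P) (∈-row y 0 (suc p) x z≤n (≤∧≢⇒< (ℕ.s≤s⁻¹ x<P) x≢p+1))))

  ∈-tour-with-mirror : ∀ {v} → v ∈ c₀ ∷ W → (v ∈ c₀ ∷ tour) × (ρ v ∈ c₀ ∷ tour)
  ∈-tour-with-mirror (here refl) = here refl , there (∈-++⁺ʳ (pairs ρ id W) (here refl))
  ∈-tour-with-mirror (there v∈W) = there (∈-++⁺ˡ (proj₂ both)) , there (∈-++⁺ˡ (proj₁ both))
    where both = ∈-pairs ρ id W v∈W

  covers : ∀ x y → InGrid A B (x , y) → (x , y) ∈ c₀ ∷ tour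
  covers = covers-by-halves P (c₀ ∷ W) (c₀ ∷ tour) mirror-left ∈-left ∈-tour-with-mirror

-- a = 2p + 4 and b = 2q + 4 both even; the left half consists of the columns x < p + 2.
-- Start at s₀ = (p + 1, q + 1) next to the centre and visit w, ρ w for w in
-- s₀, lower (rows ≤ q, then row q + 1 up to x = p), upper (row q + 2 up to x = p,
-- rows ≥ q + 3, then t₀ = (p + 1, q + 2)).  Only the passage from the lower to the
-- upper part has slack (namely 2), and both ends have potential 2: excess 6.
module EvenEvenTour (p q : ℕ) where
  open EvenWidth p public
  Q = suc (suc q)
  b' = suc (dbl (suc q))
  open Reflection a' b' public

  s₀ t₀ : Point
  s₀ = (suc p , suc q)
  t₀ = (suc p , Q)

  lower upper upper′ rest : List Point
  lower = block 0 (suc q) P ++ row (suc q) 0 (suc p)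
  upper = row Q 0 (suc p) ++ block (suc Q) (suc q) P ++ t₀ ∷ []
  upper′ = row Q 1 p ++ block (suc Q) (suc q) P ++ t₀ ∷ []   -- upper = (0 , Q) ∷ upper′
  rest = ρ s₀ ∷ pairs id ρ (lower ++ upper)                -- s₀ ∷ rest = pairs id ρ (s₀ ∷ lower ++ upper)

  -- the upper block ends at the last row
  upper-end : suc Q + suc q ≡ suc b'
  upper-end = trans (shift q) (cong (suc ∘ suc ∘ suc ∘ suc) (sym (dbl≡+ q)))
    where
    shift : ∀ q → suc (suc (suc q)) + suc q ≡ suc (suc (suc (suc (q + q))))
    shift = solve-∀

  left-s₀ : LeftHalf s₀
  left-s₀ = (grid-x (n<1+n (suc p)) , s≤s (≤-trans (n≤dbl (suc q)) (n≤1+n _))) , left-x (n<1+n (suc p))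
  left-t₀ : LeftHalf t₀
  left-t₀ = (grid-x (n<1+n (suc p)) , s≤s (s≤s (n≤dbl (suc q)))) , left-x (n<1+n (suc p))

  left-lower : All LeftHalf lower
  left-lower = All++⁺
     (All-block 0 (suc q) P (λ x y x<P _ y<q+1 → (grid-x x<P , s≤s (≤-trans (<⇒≤ y<q+1) (≤-trans (n≤dbl (suc q)) (n≤1+n _)))) , left-x x<P))
     (All-row (suc q) 0 (suc p) (λ x _ x≤p → (grid-x (≤-trans x≤p (n≤1+n _)) , proj₂ (proj₁ left-s₀)) , left-x (≤-trans x≤p (n≤1+n _))))

  left-upper : All LeftHalf upper
  left-upper = All++⁺
     (All-row Q 0 (suc p) (λ x _ x≤p → (grid-x (≤-trans x≤p (n≤1+n _)) , proj₂ (proj₁ left-t₀)) , left-x (≤-trans x≤p (n≤1+n _))))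
     (All++⁺ (All-block (suc Q) (suc q) P (λ x y x<P _ y<end → (grid-x x<P , subst (y <_) upper-end y<end) , left-x x<P))
             (left-t₀ ∷ []))

  lower-lower : All Lower (s₀ ∷ lower)
  lower-lower = n≤1+n _ ∷ All++⁺
      (All-block 0 (suc q) P (λ x y _ _ y<q+1 → ≤-trans (dbl-mono (<⇒≤ y<q+1)) (n≤1+n _)))
      (All-row (suc q) 0 (suc p) (λ _ _ _ → n≤1+n _))

  upper-upper : All Upper upper
  upper-upper = All++⁺
      (All-row Q 0 (suc p) (λ _ _ _ → n≤1+n _))
      (All++⁺ (All-block (suc Q) (suc q) P (λ x y _ Q<y _ → ≤-trans (n≤1+n _) (dbl-mono (<⇒≤ Q<y))))
              (n≤1+n _ ∷ []))

  -- The passage from ρ (p, q + 1), the mirror of the end of the lower part, to (0, Q).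
  last-lower : lastOf s₀ lower ≡ (p , suc q)
  last-lower = trans (lastOf-++ s₀ (block 0 (suc q) P) (0 , suc q) (row (suc q) 1 p)) (lastOf-row (suc q) 0 p)

  slack-passage : s (ρ (p , suc q)) (0 , Q) ≡ 2
  slack-passage = begin
      s (a' ∸ p , b' ∸ suc q) (0 , Q)
    ≡⟨ slack-opposite-x a' b' (a' ∸ p) (b' ∸ suc q) 0 Q (inj₂ (z≤n , mirror-below (dbl-mirror a' p p≤a') (left-x (≤-trans (n≤1+n (suc p)) (n<1+n (suc p)))))) ⟩
      (fromCentre b' (b' ∸ suc q) + fromCentre b' Q) ∸ ∣ dbl (b' ∸ suc q) - dbl Q ∣
    ≡⟨ cong (λ z → (fromCentre b' z + fromCentre b' Q) ∸ ∣ dbl z - dbl Q ∣) mirror-row ⟩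
      (fromCentre b' Q + fromCentre b' Q) ∸ ∣ dbl Q - dbl Q ∣
    ≡⟨ cong₂ _∸_ (cong₂ _+_ (∣1+n-n∣≡1 b') (∣1+n-n∣≡1 b')) (∣n-n∣≡0 (dbl Q)) ⟩
      2 ∎
    where
    open ≡-Reasoning
    p≤a' : p ≤ a'
    p≤a' = ≤-trans (n≤1+n p) (≤-trans (n≤dbl (suc p)) (n≤1+n _))
    mirror-row : b' ∸ suc q ≡ Q
    mirror-row = trans (+-∸-assoc 2 (n≤dbl q)) (cong (suc ∘ suc) (dbl∸ q))

  chain-tour : chain s (s₀ ∷ rest) ≡ 2
  chain-tour = begin
      chain s (s₀ ∷ rest)
    ≡⟨ cong (λ L → chain s (s₀ ∷ ρ s₀ ∷ L)) (pairs-++ id ρ lower upper) ⟩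
      chain s (s₀ ∷ (ρ s₀ ∷ pairs id ρ lower) ++ (0 , Q) ∷ (ρ (0 , Q) ∷ pairs id ρ upper′))
    ≡⟨ chain-++ s s₀ (ρ s₀ ∷ pairs id ρ lower) (0 , Q) (ρ (0 , Q) ∷ pairs id ρ upper′) ⟩
      chain s (pairs id ρ (s₀ ∷ lower)) + s (lastOf s₀ (ρ s₀ ∷ pairs id ρ lower)) (0 , Q) + chain s (pairs id ρ upper)
    ≡⟨ cong₂ _+_ (cong₂ _+_ lower-slackless (trans (cong (λ z → s z (0 , Q)) (trans (lastOf-pairs ρ s₀ lower) (cong ρ last-lower))) slack-passage)) upper-slackless ⟩
      2 ∎
    where
    open ≡-Reasoning
    lower-slackless = chain-pairs-mirror (left-s₀ ∷ left-lower) (Linked-all (λ l l' → inj₁ (l , l')) lower-lower)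
    upper-slackless = chain-pairs-mirror left-upper (Linked-all (λ u u' → inj₂ (u , u')) upper-upper)

  potential-s₀ : h s₀ ≡ 2
  potential-s₀ = cong₂ _+_ (∣n-1+n∣≡1 (dbl (suc p))) (∣n-1+n∣≡1 (dbl (suc q)))

  potential-last : h (lastOf s₀ rest) ≡ 2
  potential-last = trans (cong h last-rest) (trans (potential-ρ t₀ (proj₁ left-t₀)) (cong₂ _+_ (∣n-1+n∣≡1 (dbl (suc p))) (∣1+n-n∣≡1 b')))
    where
    last-rest : lastOf s₀ rest ≡ ρ t₀
    last-rest = trans (lastOf-pairs ρ s₀ (lower ++ upper)) (cong ρ (trans (lastOf-++ s₀ lower (0 , Q) upper′)
      (trans (cong (lastOf (0 , Q)) (sym (++-assoc (row Q 1 p) (block (suc Q) (suc q) P) (t₀ ∷ []))))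
             (lastOf-++ (0 , Q) (row Q 1 p ++ block (suc Q) (suc q) P) t₀ []))))

  in-grid : All (InGrid A B) (s₀ ∷ rest)
  in-grid = All-pairs id ρ id InGrid-ρ (All.map proj₁ (left-s₀ ∷ All++⁺ left-lower left-upper))

  length-tour : length (s₀ ∷ rest) ≡ A * B
  length-tour = begin
      length (pairs id ρ (s₀ ∷ lower ++ upper))
    ≡⟨ length-pairs id ρ (s₀ ∷ lower ++ upper) ⟩
      2 * suc (length (lower ++ upper))
    ≡⟨ cong (λ z → 2 * suc z) (trans (length-++ lower) (cong₂ _+_
         (trans (length-++ (block 0 (suc q) P)) (cong₂ _+_ (length-block 0 (suc q) P) (length-row (suc q) 0 (suc p))))
         (trans (length-++ (row Q 0 (suc p))) (cong₂ _+_ (length-row Q 0 (suc p))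
            (trans (length-++ (block (suc Q) (suc q) P)) (cong (_+ 1) (length-block (suc Q) (suc q) P))))))) ⟩
      2 * suc ((suc q * P + suc p) + (suc p + (suc q * P + 1)))
    ≡⟨ count p q ⟩
      suc (suc (2 * suc p)) * suc (suc (2 * suc q))
    ≡⟨ cong₂ (λ z w → suc (suc z) * suc (suc w)) (sym (dbl≡2* (suc p))) (sym (dbl≡2* (suc q))) ⟩
      A * B ∎
    where
    open ≡-Reasoning
    count : ∀ p q → 2 * suc ((suc q * suc (suc p) + suc p) + (suc p + (suc q * suc (suc p) + 1))) ≡ suc (suc (2 * suc p)) * suc (suc (2 * suc q))
    count = solve-∀

  ∈-left : ∀ x y → x < P → y < B → (x , y) ∈ s₀ ∷ lower ++ upper
  ∈-left x y x<P y<B with <-cmp y (suc q)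
  ... | tri< y<q+1 _ _ = there (∈-++⁺ˡ (∈-++⁺ˡ (∈-block 0 (suc q) P x y x<P z≤n y<q+1)))
  ... | tri≈ _ refl _ with x ℕ.≟ suc p
  ...   | yes refl = here refl
  ...   | no x≢p+1 = there (∈-++⁺ˡ (∈-++⁺ʳ (block 0 (suc q) P) (∈-row y 0 (suc p) x z≤n (≤∧≢⇒< (ℕ.s≤s⁻¹ x<P) x≢p+1))))
  ∈-left x y x<P y<B | tri> _ _ q+1<y with <-cmp y Q
  ...   | tri< y<Q _ _ = ⊥-elim (<⇒≱ y<Q q+1<y)
  ...   | tri> _ _ Q<y = there (∈-++⁺ʳ lower (∈-++⁺ʳ (row Q 0 (suc p)) (∈-++⁺ˡ (∈-block (suc Q) (suc q) P x y x<P Q<y (subst (y <_) (sym upper-end) y<B)))))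
  ...   | tri≈ _ refl _ with x ℕ.≟ suc p
  ...     | yes refl = there (∈-++⁺ʳ lower (∈-++⁺ʳ (row Q 0 (suc p)) (∈-++⁺ʳ (block (suc Q) (suc q) P) (here refl))))
  ...     | no x≢p+1 = there (∈-++⁺ʳ lower (∈-++⁺ˡ (∈-row y 0 (suc p) x z≤n (≤∧≢⇒< (ℕ.s≤s⁻¹ x<P) x≢p+1))))

  covers : ∀ x y → InGrid A B (x , y) → (x , y) ∈ s₀ ∷ rest
  covers = covers-by-halves P (s₀ ∷ lower ++ upper) (s₀ ∷ rest) mirror-left ∈-left (∈-pairs id ρ (s₀ ∷ lower ++ upper))

-- a = 2p + 3 and b = 2q + 3 both odd; the centre z = (p + 1, q + 1) is a vertex of
-- potential 0.  The half visited directly is: the columns x ≤ p, and column p + 1 below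
-- the centre.  Start at x₀ = (p + 1, q), visit w, ρ w for w in x₀, lower (row q up to
-- x = p, rows < q up to x = p + 1, row q + 1 up to x = p), upper (rows ≥ q + 2 up to
-- x = p), and finish at z.  Every step is slackless (z is opposite to every vertex in
-- both coordinates), h x₀ = 2 and h z = 0: excess 2.
module OddOddTour (p q : ℕ) where
  a' = dbl (suc p)
  b' = dbl (suc q)
  open Reflection a' b' public

  z x₀ : Point
  z = (suc p , suc q)
  x₀ = (suc p , q)

  lower upper rest : List Point
  lower = row q 0 (suc p) ++ block 0 q (suc (suc p)) ++ row (suc q) 0 (suc p)
  upper = block (suc (suc q)) (suc q) (suc p)
  rest = ρ x₀ ∷ pairs id ρ (lower ++ upper) ++ z ∷ []

  left-x : ∀ {x} → x < suc (suc p) → dbl x ≤ a'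
  left-x x≤p+1 = dbl-mono (ℕ.s≤s⁻¹ x≤p+1)
  grid-x : ∀ {x} → x < suc (suc p) → x < A
  grid-x x≤p+1 = ≤-trans x≤p+1 (s≤s (n≤dbl (suc p)))
  -- the upper block ends at the last row
  upper-end : suc (suc q) + suc q ≡ B
  upper-end = cong suc (sym (dbl≡+ (suc q)))

  left-x₀ : LeftHalf x₀
  left-x₀ = (grid-x ≤-refl , s≤s (≤-trans (n≤1+n q) (n≤dbl (suc q)))) , left-x ≤-refl

  left-W : All LeftHalf (lower ++ upper)
  left-W = All++⁺
    (All++⁺ (All-row q 0 (suc p) (λ x _ x≤p → (grid-x (≤-trans x≤p (n≤1+n _)) , proj₂ (proj₁ left-x₀)) , left-x (≤-trans x≤p (n≤1+n _))))
      (All++⁺ (All-block 0 q (suc (suc p)) (λ x y x≤p+1 _ y<q → (grid-x x≤p+1 , s≤s (≤-trans (<⇒≤ y<q) (≤-trans (n≤1+n q) (n≤dbl (suc q))))) , left-x x≤p+1))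
              (All-row (suc q) 0 (suc p) (λ x _ x≤p → (grid-x (≤-trans x≤p (n≤1+n _)) , s≤s (n≤dbl (suc q))) , left-x (≤-trans x≤p (n≤1+n _))))))
    (All-block (suc (suc q)) (suc q) (suc p) (λ x y x≤p _ y<end → (grid-x (≤-trans x≤p (n≤1+n _)) , subst (y <_) upper-end y<end) , left-x (≤-trans x≤p (n≤1+n _))))

  linked-W : Linked SameSideY (x₀ ∷ lower ++ upper)
  linked-W = Linked-lower-upper x₀ lower upper
    (dbl-mono (n≤1+n q) ∷ All++⁺ (All-row q 0 (suc p) (λ _ _ _ → dbl-mono (n≤1+n q)))
      (All++⁺ (All-block 0 q (suc (suc p)) (λ x y _ _ y<q → dbl-mono (≤-trans (<⇒≤ y<q) (n≤1+n q))))
              (All-row (suc q) 0 (suc p) (λ _ _ _ → ≤-refl))))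
    (All-block (suc (suc q)) (suc q) (suc p) (λ x y _ q+1<y _ → dbl-mono (<⇒≤ q+1<y)))
    (subst Upper (sym (trans (cong (lastOf x₀) (sym (++-assoc (row q 0 (suc p)) (block 0 q (suc (suc p))) (row (suc q) 0 (suc p)))))
                             (lastOf-++ x₀ (row q 0 (suc p) ++ block 0 q (suc (suc p))) (0 , suc q) (row (suc q) 1 p))))
       (lastOf-All {Upper} (0 , suc q) (row (suc q) 1 p) (≤-refl ∷ All-row (suc q) 1 p (λ _ _ _ → ≤-refl))))

  -- The centre is opposite to every point in both coordinates.
  slackless-to-centre : ∀ v → s v z ≡ 0
  slackless-to-centre (x , y) = slack-zero a' b' x y (suc p) (suc q) (towards a' (dbl x)) (towards b' (dbl y))
    where
    towards : ∀ c X → Opposite c X c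
    towards c X with ≤-total X c
    ... | inj₁ X≤c = inj₁ (X≤c , ≤-refl)
    ... | inj₂ c≤X = inj₂ (≤-refl , c≤X)

  chain-tour : chain s (x₀ ∷ rest) ≡ 0
  chain-tour = trans (chain-++ s x₀ (ρ x₀ ∷ pairs id ρ (lower ++ upper)) z [])
    (cong₂ _+_ (cong₂ _+_ (chain-pairs-mirror (left-x₀ ∷ left-W) linked-W) (slackless-to-centre (lastOf x₀ (ρ x₀ ∷ pairs id ρ (lower ++ upper))))) refl)

  potential-x₀ : h x₀ ≡ 2
  potential-x₀ = cong₂ _+_ (∣n-n∣≡0 (dbl (suc p))) (two-below (dbl q))
    where
    two-below : ∀ n → ∣ n - suc (suc n) ∣ ≡ 2
    two-below zero = refl
    two-below (suc n) = two-below n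

  potential-last : h (lastOf x₀ rest) ≡ 0
  potential-last = trans (cong h (lastOf-++ x₀ (ρ x₀ ∷ pairs id ρ (lower ++ upper)) z []))
                         (cong₂ _+_ (∣n-n∣≡0 (dbl (suc p))) (∣n-n∣≡0 (dbl (suc q))))

  in-grid : All (InGrid A B) (x₀ ∷ rest)
  in-grid = All++⁺ (All-pairs id ρ id InGrid-ρ (All.map proj₁ (left-x₀ ∷ left-W))) ((grid-x ≤-refl , s≤s (n≤dbl (suc q))) ∷ [])

  length-tour : length (x₀ ∷ rest) ≡ A * B
  length-tour = begin
      length (pairs id ρ (x₀ ∷ lower ++ upper) ++ z ∷ [])
    ≡⟨ length-++ (pairs id ρ (x₀ ∷ lower ++ upper)) ⟩
      length (pairs id ρ (x₀ ∷ lower ++ upper)) + 1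
    ≡⟨ cong (_+ 1) (trans (length-pairs id ρ (x₀ ∷ lower ++ upper)) (cong (λ t → 2 * suc t) (trans (length-++ lower)
         (cong₂ _+_ (trans (length-++ (row q 0 (suc p))) (cong₂ _+_ (length-row q 0 (suc p))
              (trans (length-++ (block 0 q (suc (suc p)))) (cong₂ _+_ (length-block 0 q (suc (suc p))) (length-row (suc q) 0 (suc p))))))
            (length-block (suc (suc q)) (suc q) (suc p)))))) ⟩
      2 * suc ((suc p + (q * suc (suc p) + suc p)) + suc q * suc p) + 1
    ≡⟨ count p q ⟩
      suc (2 * suc p) * suc (2 * suc q)
    ≡⟨ cong₂ (λ x y → suc x * suc y) (sym (dbl≡2* (suc p))) (sym (dbl≡2* (suc q))) ⟩
      A * B ∎
    where
    open ≡-Reasoning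
    count : ∀ p q → 2 * suc ((suc p + (q * suc (suc p) + suc p)) + suc q * suc p) + 1 ≡ suc (2 * suc p) * suc (2 * suc q)
    count = solve-∀

  ∈-half : ∀ x y → (x < suc p ⊎ (x ≡ suc p × y < suc q)) → y < B → (x , y) ∈ x₀ ∷ lower ++ upper
  ∈-half x y half y<B with <-cmp y q
  ... | tri< y<q _ _ = there (∈-++⁺ˡ (∈-++⁺ʳ (row q 0 (suc p)) (∈-++⁺ˡ (∈-block 0 q (suc (suc p)) x y (column half) z≤n y<q))))
    where
    column : (x < suc p ⊎ (x ≡ suc p × y < suc q)) → x < suc (suc p)
    column (inj₁ x≤p) = ≤-trans x≤p (n≤1+n _)
    column (inj₂ (refl , _)) = ≤-refl
  ∈-half x y (inj₁ x≤p) y<B | tri≈ _ refl _ = there (∈-++⁺ˡ (∈-++⁺ˡ (∈-row y 0 (suc p) x z≤n x≤p)))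
  ∈-half x y (inj₂ (refl , _)) y<B | tri≈ _ refl _ = here refl
  ∈-half x y (inj₂ (refl , y≤q)) y<B | tri> _ _ q<y = ⊥-elim (<⇒≱ q<y (ℕ.s≤s⁻¹ y≤q))
  ∈-half x y (inj₁ x≤p) y<B | tri> _ _ q<y with <-cmp y (suc q)
  ... | tri< y<q+1 _ _ = ⊥-elim (<⇒≱ y<q+1 q<y)
  ... | tri≈ _ refl _ = there (∈-++⁺ˡ (∈-++⁺ʳ (row q 0 (suc p)) (∈-++⁺ʳ (block 0 q (suc (suc p))) (∈-row y 0 (suc p) x z≤n x≤p))))
  ... | tri> _ _ q+1<y = there (∈-++⁺ʳ lower (∈-block (suc (suc q)) (suc q) (suc p) x y x≤p q+1<y (subst (y <_) (sym upper-end) y<B)))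

  ∈-tour-with-mirror : ∀ {v} → v ∈ x₀ ∷ lower ++ upper → (v ∈ x₀ ∷ rest) × (ρ v ∈ x₀ ∷ rest)
  ∈-tour-with-mirror v∈ = ∈-++⁺ˡ (proj₁ both) , ∈-++⁺ˡ (proj₂ both)
    where both = ∈-pairs id ρ (x₀ ∷ lower ++ upper) v∈

  covers : ∀ x y → InGrid A B (x , y) → (x , y) ∈ x₀ ∷ rest
  covers x y (x<A , y<B) with <-cmp x (suc p)
  ... | tri< x≤p _ _ = proj₁ (∈-tour-with-mirror (∈-half x y (inj₁ x≤p) y<B))
  ... | tri> _ _ p+1<x = subst (_∈ x₀ ∷ rest) (ρ-involutive (x , y) (x<A , y<B))
          (proj₂ (∈-tour-with-mirror (∈-half (a' ∸ x) (b' ∸ y) (inj₁ mirror-x) (proj₂ (InGrid-ρ (x<A , y<B))))))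
    where
    mirror-x : a' ∸ x < suc p
    mirror-x = s≤s (≤-trans (∸-monoʳ-≤ a' p+1<x) (≤-reflexive (dbl∸ p)))
  ... | tri≈ _ refl _ with <-cmp y (suc q)
  ...   | tri< y≤q _ _ = proj₁ (∈-tour-with-mirror (∈-half x y (inj₂ (refl , y≤q)) y<B))
  ...   | tri≈ _ refl _ = ∈-++⁺ʳ (pairs id ρ (x₀ ∷ lower ++ upper)) (here refl)
  ...   | tri> _ _ q+1<y = subst (_∈ x₀ ∷ rest) (ρ-involutive (x , y) (x<A , y<B))
          (proj₂ (∈-tour-with-mirror (∈-half (a' ∸ x) (b' ∸ y) (inj₂ (dbl∸ (suc p) , mirror-y)) (proj₂ (InGrid-ρ (x<A , y<B))))))
    where
    mirror-y : b' ∸ y < suc q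
    mirror-y = s≤s (≤-trans (∸-monoʳ-≤ b' q+1<y) (≤-reflexive (dbl∸ q)))

t⁺-even-even : ∀ p q → GridUpperTraceable (dbl (suc (suc p))) (dbl (suc (suc q))) (total (dbl (suc (suc p))) (dbl (suc (suc q))) ∸ 3)
t⁺-even-even p q =
  Listed.list⇒ordering a' b' 3 s₀ rest length-tour in-grid covers (cong₂ _+_ (cong₂ _+_ chain-tour potential-s₀) potential-last) ,
  excess⇒upper-bound (suc a') (suc b') 3 (EvenEvenColouring.excess-bound (suc p) (suc q))
  where open EvenEvenTour p q

t⁺-even-odd : ∀ p q → GridUpperTraceable (dbl (suc (suc p))) (suc (dbl q)) (total (dbl (suc (suc p))) (suc (dbl q)) ∸ 1)
t⁺-even-odd p q =
  Listed.list⇒ordering a' b' 1 c₀ tour length-tour in-grid covers (cong₂ _+_ (cong₂ _+_ chain-tour potential-c₀) potential-last) ,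
  excess⇒upper-bound (suc a') (suc b') 1 (λ m u _ → excess-bound-even-side (suc p) (suc b') m u)
  where open EvenOddTour p q

t⁺-odd-odd : ∀ p q → GridUpperTraceable (suc (dbl (suc p))) (suc (dbl (suc q))) (total (suc (dbl (suc p))) (suc (dbl (suc q))) ∸ 1)
t⁺-odd-odd p q =
  Listed.list⇒ordering a' b' 1 x₀ rest length-tour in-grid covers (cong₂ _+_ (cong₂ _+_ chain-tour potential-x₀) potential-last) ,
  excess⇒upper-bound (suc a') (suc b') 1 (excess-bound-odd-odd (suc p) (suc q))
  where open OddOddTour p q

swap : ∀ {a b} → Vertex a b → Vertex b a
swap (x , y) = (y , x)

pathSum-swap : ∀ {a b} n (u : Fin n → Vertex a b) → pathSum (gridDist {b} {a}) n (swap ∘ u) ≡ pathSum (gridDist {a} {b}) n u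
pathSum-swap zero u = refl
pathSum-swap (suc zero) u = refl
pathSum-swap (suc (suc n)) u = cong₂ _+_ (+-comm ∣ toℕ (proj₂ (u F.zero)) - toℕ (proj₂ (u (F.suc F.zero))) ∣ _) (pathSum-swap (suc n) (u ∘ F.suc))

ordering-swap : ∀ {a b n} (u : Fin n → Vertex a b) → Ordering n u → Ordering n (swap ∘ u)
ordering-swap u (one-to-one , onto) =
  (λ e → one-to-one (cong swap e)) , λ v → proj₁ (onto (swap v)) , λ e → cong swap (proj₂ (onto (swap v)) e)

transpose : ∀ a b t → GridUpperTraceable a b t → GridUpperTraceable b a t
transpose a b t ((u , ord , length≡t) , bound) =
  subst (λ n → Σ (Fin n → Vertex b a) λ u → Ordering n u × pathSum (gridDist {b} {a}) n u ≡ t) (*-comm a b)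
        (swap ∘ u , ordering-swap u ord , trans (pathSum-swap (a * b) u) length≡t) ,
  subst (λ n → ∀ (u : Fin n → Vertex b a) → Ordering n u → pathSum (gridDist {b} {a}) n u ≤ t) (*-comm a b)
        (λ u ord → subst (_≤ t) (pathSum-swap (a * b) u) (bound (swap ∘ u) (ordering-swap u ord)))

double-total-even-even : ∀ P Q → dbl P * dbl P * dbl Q + dbl Q * dbl Q * dbl P ≡ 2 * total (dbl P) (dbl Q)
double-total-even-even P Q = begin
    dbl P * dbl P * dbl Q + dbl Q * dbl Q * dbl P
  ≡⟨ cong₂ (λ x y → x * x * y + y * y * x) (dbl≡2* P) (dbl≡2* Q) ⟩
    2 * P * (2 * P) * (2 * Q) + 2 * Q * (2 * Q) * (2 * P)
  ≡⟨ expand P Q ⟩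
    2 * (2 * Q * (2 * P * P) + 2 * P * (2 * Q * Q))
  ≡⟨ cong (2 *_) (cong₂ _+_ (cong₂ _*_ (sym (dbl≡2* Q)) (sym (spread-even P))) (cong₂ _*_ (sym (dbl≡2* P)) (sym (spread-even Q)))) ⟩
    2 * total (dbl P) (dbl Q) ∎
  where
  open ≡-Reasoning
  expand : ∀ P Q → 2 * P * (2 * P) * (2 * Q) + 2 * Q * (2 * Q) * (2 * P) ≡ 2 * (2 * Q * (2 * P * P) + 2 * P * (2 * Q * Q))
  expand = solve-∀

double-total-even-odd : ∀ P q → dbl P * dbl P * suc (dbl q) + suc (dbl q) * suc (dbl q) * dbl P ≡ 2 * total (dbl P) (suc (dbl q)) + dbl P
double-total-even-odd P q = begin
    dbl P * dbl P * suc (dbl q) + suc (dbl q) * suc (dbl q) * dbl P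
  ≡⟨ cong₂ (λ x y → x * x * suc y + suc y * suc y * x) (dbl≡2* P) (dbl≡2* q) ⟩
    2 * P * (2 * P) * suc (2 * q) + suc (2 * q) * suc (2 * q) * (2 * P)
  ≡⟨ expand P q ⟩
    2 * (suc (2 * q) * (2 * P * P) + 2 * P * (2 * q * suc q)) + 2 * P
  ≡⟨ cong₂ (λ t d → 2 * t + d) (cong₂ _+_ (cong₂ _*_ (cong suc (sym (dbl≡2* q))) (sym (spread-even P)))
                                          (cong₂ _*_ (sym (dbl≡2* P)) (sym (spread-odd q)))) (sym (dbl≡2* P)) ⟩
    2 * total (dbl P) (suc (dbl q)) + dbl P ∎
  where
  open ≡-Reasoning
  expand : ∀ P q → 2 * P * (2 * P) * suc (2 * q) + suc (2 * q) * suc (2 * q) * (2 * P) ≡ 2 * (suc (2 * q) * (2 * P * P) + 2 * P * (2 * q * suc q)) + 2 * P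
  expand = solve-∀

double-total-odd-odd : ∀ p q → suc (dbl p) * suc (dbl p) * suc (dbl q) + suc (dbl q) * suc (dbl q) * suc (dbl p)
                               ≡ 2 * total (suc (dbl p)) (suc (dbl q)) + suc (dbl q) + suc (dbl p)
double-total-odd-odd p q = begin
    suc (dbl p) * suc (dbl p) * suc (dbl q) + suc (dbl q) * suc (dbl q) * suc (dbl p)
  ≡⟨ cong₂ (λ x y → suc x * suc x * suc y + suc y * suc y * suc x) (dbl≡2* p) (dbl≡2* q) ⟩
    suc (2 * p) * suc (2 * p) * suc (2 * q) + suc (2 * q) * suc (2 * q) * suc (2 * p)
  ≡⟨ expand p q ⟩
    2 * (suc (2 * q) * (2 * p * suc p) + suc (2 * p) * (2 * q * suc q)) + suc (2 * q) + suc (2 * p)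
  ≡⟨ cong₃ (λ t d e → 2 * t + suc d + suc e)
       (cong₂ _+_ (cong₂ _*_ (cong suc (sym (dbl≡2* q))) (sym (spread-odd p))) (cong₂ _*_ (cong suc (sym (dbl≡2* p))) (sym (spread-odd q))))
       (sym (dbl≡2* q)) (sym (dbl≡2* p)) ⟩
    2 * total (suc (dbl p)) (suc (dbl q)) + suc (dbl q) + suc (dbl p) ∎
  where
  open ≡-Reasoning
  expand : ∀ p q → suc (2 * p) * suc (2 * p) * suc (2 * q) + suc (2 * q) * suc (2 * q) * suc (2 * p)
                   ≡ 2 * (suc (2 * q) * (2 * p * suc p) + suc (2 * p) * (2 * q * suc q)) + suc (2 * q) + suc (2 * p)
  expand = solve-∀
  cong₃ : ∀ (f : ℕ → ℕ → ℕ → ℕ) {x x' y y' z z'} → x ≡ x' → y ≡ y' → z ≡ z' → f x y z ≡ f x' y' z'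
  cong₃ f refl refl refl = refl

half-of : ∀ {n} T → n ≡ 2 * T → n / 2 ≡ T
half-of T refl = trans (cong (_/ 2) (*-comm 2 T)) (m*n/n≡m T 2)

parity : ∀ n → (∃ λ k → n ≡ dbl k) ⊎ (∃ λ k → n ≡ suc (dbl k))
parity zero = inj₁ (0 , refl)
parity (suc n) with parity n
... | inj₁ (k , n≡2k) = inj₂ (k , cong suc n≡2k)
... | inj₂ (k , n≡2k+1) = inj₁ (suc k , cong suc n≡2k+1)

2∣dbl : ∀ k → 2 ∣ dbl k
2∣dbl k = divides k (trans (dbl≡2* k) (*-comm 2 k))

2∤odd : ∀ k → ¬ (2 ∣ suc (dbl k))
2∤odd k (divides m e) = dbl≢odd m k (trans (trans (dbl≡2* m) (*-comm 2 m)) (sym e))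

even-shape : ∀ {n} → 2 < n → 2 ∣ n → ∃ λ p → n ≡ dbl (suc (suc p))
even-shape {n} 2<n 2∣n with parity n
... | inj₂ (k , refl) = ⊥-elim (2∤odd k 2∣n)
... | inj₁ (zero , refl) = ⊥-elim (<⇒≱ 2<n z≤n)
... | inj₁ (suc zero , refl) = ⊥-elim (<-irrefl refl 2<n)
... | inj₁ (suc (suc p) , refl) = p , refl

odd-shape : ∀ {n} → 2 < n → ¬ (2 ∣ n) → ∃ λ p → n ≡ suc (dbl (suc p))
odd-shape {n} 2<n 2∤n with parity n
... | inj₁ (k , refl) = ⊥-elim (2∤n (2∣dbl k))
... | inj₂ (zero , refl) = ⊥-elim (<⇒≱ 2<n (s≤s z≤n))
... | inj₂ (suc p , refl) = p , refl

theorem3p1 : (a b : ℕ) → 2 < a → 2 < b →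
    ((2 ∣ a) → (2 ∣ b) →
      GridUpperTraceable a b (((a * a * b + b * b * a) / 2) ∸ 3))
    × ((2 ∣ a) → ¬ (2 ∣ b) →
      GridUpperTraceable a b (((a * a * b + b * b * a ∸ a) / 2) ∸ 1))
    × (¬ (2 ∣ a) → (2 ∣ b) →
      GridUpperTraceable a b (((a * a * b + b * b * a ∸ b) / 2) ∸ 1))
    × (¬ (2 ∣ a) → ¬ (2 ∣ b) →
      GridUpperTraceable a b (((a * a * b + b * b * a ∸ a ∸ b) / 2) ∸ 1))
theorem3p1 a b 2<a 2<b = both-even , even-odd , odd-even , both-odd
  where
  value : ∀ {t t'} k → t' ≡ t → GridUpperTraceable a b (t ∸ k) → GridUpperTraceable a b (t' ∸ k)
  value k t'≡t = subst (λ t → GridUpperTraceable a b (t ∸ k)) (sym t'≡t)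

  both-even : 2 ∣ a → 2 ∣ b → GridUpperTraceable a b (((a * a * b + b * b * a) / 2) ∸ 3)
  both-even 2∣a 2∣b with even-shape 2<a 2∣a | even-shape 2<b 2∣b
  ... | p , refl | q , refl = value 3 (half-of (total a b) (double-total-even-even (suc (suc p)) (suc (suc q)))) (t⁺-even-even p q)

  even-odd : 2 ∣ a → ¬ (2 ∣ b) → GridUpperTraceable a b (((a * a * b + b * b * a ∸ a) / 2) ∸ 1)
  even-odd 2∣a 2∤b with even-shape 2<a 2∣a | odd-shape 2<b 2∤b
  ... | p , refl | q , refl = value 1 (half-of (total a b) (trans (cong (_∸ a) (double-total-even-odd (suc (suc p)) (suc q))) (m+n∸n≡m _ a)))
                                      (t⁺-even-odd p (suc q))

  odd-even : ¬ (2 ∣ a) → 2 ∣ b → GridUpperTraceable a b (((a * a * b + b * b * a ∸ b) / 2) ∸ 1)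
  odd-even 2∤a 2∣b with odd-shape 2<a 2∤a | even-shape 2<b 2∣b
  ... | p , refl | q , refl = value 1 (half-of (total b a) (trans (cong (_∸ b) (trans (+-comm (a * a * b) (b * b * a)) (double-total-even-odd (suc (suc q)) (suc p))))
                                                      (m+n∸n≡m _ b)))
                                      (transpose b a _ (t⁺-even-odd q (suc p)))

  both-odd : ¬ (2 ∣ a) → ¬ (2 ∣ b) → GridUpperTraceable a b (((a * a * b + b * b * a ∸ a ∸ b) / 2) ∸ 1)
  both-odd 2∤a 2∤b with odd-shape 2<a 2∤a | odd-shape 2<b 2∤b
  ... | p , refl | q , refl = value 1 (half-of (total a b) (trans (cong (λ n → n ∸ a ∸ b) (double-total-odd-odd (suc p) (suc q)))
                                                      (trans (cong (_∸ b) (m+n∸n≡m (2 * total a b + b) a)) (m+n∸n≡m (2 * total a b) b))))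
                                      (t⁺-odd-odd p q)
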